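{- Let $n\ge3$, $\boldsymbol a\in\{0,1\}^{n-1}$, $\vec\sigma\in\{0,1\}^n$, and let $\mu_{\boldsymbol j,\boldsymbol m}$ be the Haar coefficients of $\Delta(\cdot,\mathcal{P}_{\boldsymbol a}(\vec\sigma))$. Let $\mathcal J_9=\{(j_1,j_2)\in\mathbb N_0^2: j_1+j_2\le n-2,\ j_1\ge1\}$. Then $$\sum_{\boldsymbol j\in\mathcal J_9}2^{j_1+j_2}\sum_{m_1=0}^{2^{j_1}-1}\sum_{m_2=0}^{2^{j_2}-1}|\mu_{\boldsymbol j,(m_1,m_2)}|^2=\frac19\,4^{ -2n-3}\bigl(3n4^n-7\cdot4^n+16\bigr).$$
   Context: $\oplus$ denotes addition modulo 2. For an integer $n\ge1$, $\boldsymbol{a}=(a_1,\dots,a_{n-1})\in\{0,1\}^{n-1}$ and $\vec{\sigma}=(\sigma_1,\dots,\sigma_n)\in\{0,1\}^n$, let $\mathcal{P}_{\boldsymbol{a}}(\vec{\sigma})\subset[0,1)^2$ be the set of the $2^n$ points $\bigl(\frac{t_n}{2}+\dots+\frac{t_1}{2^n},\ \frac{b_1}{2}+\dots+\frac{b_n}{2^n}\bigr)$, $(t_1,\dots,t_n)\in\{0,1\}^n$, with $b_k=t_k\oplus a_kt_n\oplus\sigma_k$ for $1\le k\le n-1$ and $b_n=t_n\oplus\sigma_n$. For an $N$-point set $\mathcal{P}$ the discrepancy function is $\Delta(\boldsymbol{t},\mathcal{P})=\frac1N\#\{\boldsymbol{z}\in\mathcal{P}:\boldsymbol{z}\in[0,t_1)\times[0,t_2)\}-t_1t_2$.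 Haar functions: for $j\ge0$, $m\in\{0,\dots,2^j-1\}$, $h_{j,m}$ is $+1$ on $[m2^{ -j},(m+\frac12)2^{ -j})$, $-1$ on $[(m+\frac12)2^{ -j},(m+1)2^{ -j})$ and $0$ elsewhere on $[0,1)$. For $\boldsymbol j=(j_1,j_2)$, $\boldsymbol m=(m_1,m_2)$, $h_{\boldsymbol j,\boldsymbol m}(\boldsymbol t)=h_{j_1,m_1}(t_1)h_{j_2,m_2}(t_2)$ and $\mu_{\boldsymbol j,\boldsymbol m}=\int_{[0,1)^2}\Delta(\boldsymbol t,\mathcal P)h_{\boldsymbol j,\boldsymbol m}(\boldsymbol t)\,d\boldsymbol t$. -}

module Defs where

open import Data.Bool using (Bool; true; false; _xor_; _∧_; if_then_else_)
open import Data.Nat as ℕ using (ℕ; zero; suc; _∸_)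
open import Data.Integer using (+_)
open import Data.Fin using (Fin; zero; suc; inject₁; fromℕ; toℕ)
open import Data.List using (List; []; _∷_; map; _++_; foldr; length)
open import Data.Product using (_×_; _,_; proj₁; proj₂)
open import Data.Rational using (ℚ; 0ℚ; 1ℚ; ½; _+_; _*_; _-_; _⊔_; _⊓_; ∣_∣; _/_)
open import Relation.Nullary.Decidable using (⌊_⌋)

-- 1/k for k ≥ 1 (0 for k = 0; unused)
inv : ℕ → ℚ
inv zero    = 0ℚ
inv (suc k) = + 1 / suc k

infixr 8 _^ℚ_
_^ℚ_ : ℚ → ℕ → ℚ
q ^ℚ zero  = 1ℚ
q ^ℚ suc k = q * (q ^ℚ k)

2^-_ : ℕ → ℚ
2^- k = ½ ^ℚ k

ℕ→ℚ : ℕ → ℚ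
ℕ→ℚ k = + k / 1

bit : Bool → ℚ
bit true  = 1ℚ
bit false = 0ℚ

Σ< : ℕ → (ℕ → ℚ) → ℚ
Σ< zero    f = 0ℚ
Σ< (suc k) f = Σ< k f + f k

sumList : List ℚ → ℚ
sumList = foldr _+_ 0ℚ

allBits : (n : ℕ) → List (Fin n → Bool)
allBits zero    = (λ ()) ∷ []
allBits (suc n) = map (λ t → cons false t) (allBits n) ++ map (λ t → cons true t) (allBits n)
  where
  cons : Bool → (Fin n → Bool) → Fin (suc n) → Bool
  cons b t zero    = b
  cons b t (suc i) = t i

-- The point set P_a(σ).  Indices are 0-based: Fin n index i stands for
-- the paper's index k = i+1; the last index (fromℕ m, n = suc m) is t_n.

-- x = t_n/2 + ... + t_1/2^n  = Σ_{k=1}^n t_k 2^{-(n-k+1)}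
xCoord : (n : ℕ) → (Fin n → Bool) → ℚ
xCoord n t = go n t
  where
  go : (r : ℕ) → (Fin r → Bool) → ℚ
  go zero    t = 0ℚ
  -- t zero is t_1, with weight 2^{-n}; remaining r-1 digits continue
  go (suc r) t = bit (t zero) * 2^- (suc r) + go r (λ i → t (suc i))

yCoord : (n : ℕ) → (Fin n → Bool) → ℚ
yCoord n b = go 1 n b
  where
  go : ℕ → (r : ℕ) → (Fin r → Bool) → ℚ
  go e zero    b = 0ℚ
  go e (suc r) b = bit (b zero) * 2^- e + go (suc e) r (λ i → b (suc i))

-- b_k = t_k ⊕ a_k t_n ⊕ σ_k (k ≤ n-1),  b_n = t_n ⊕ σ_n
bDigits : (m : ℕ) → (Fin m → Bool) → (Fin (suc m) → Bool) → (Fin (suc m) → Bool) → Fin (suc m) → Bool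
bDigits m a σ t i = go m a σ t i
  where
  go : (r : ℕ) → (Fin r → Bool) → (Fin (suc r) → Bool) → (Fin (suc r) → Bool) → Fin (suc r) → Bool
  go zero    a σ t zero    = t zero xor σ zero
  go (suc r) a σ t zero    = (t zero xor (a zero ∧ t (fromℕ (suc r)))) xor σ zero
  go (suc r) a σ t (suc i) = go r (λ k → a (suc k)) (λ k → σ (suc k)) (λ k → t (suc k)) i

pointSet : (n : ℕ) → (Fin (n ∸ 1) → Bool) → (Fin n → Bool) → List (ℚ × ℚ)
pointSet zero    a σ = []
pointSet (suc m) a σ =
  map (λ t → xCoord (suc m) t , yCoord (suc m) (bDigits m a σ t)) (allBits (suc m))

-- Haar coefficients of the discrepancy function, computed exactly.
-- Δ(t,P) = (1/N) Σ_{z∈P} 1[z₁<t₁] 1[z₂<t₂] − t₁ t₂, and h_{j,m} is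
-- separable, so
--   μ_{j,m} = (1/N) Σ_{z∈P} I(z₁) I'(z₂) − T T'
-- with I(z) = ∫_0^1 1[z<t] h_{j,m}(t) dt  and  T = ∫_0^1 t h_{j,m}(t) dt.

len∩ : ℚ → ℚ → ℚ → ℚ → ℚ
len∩ u v c d = 0ℚ ⊔ ((v ⊓ d) - (u ⊔ c))

hl hm hr : ℕ → ℕ → ℚ
hl j m = ℕ→ℚ m * 2^- j
hm j m = hl j m + 2^- (suc j)
hr j m = ℕ→ℚ (suc m) * 2^- j

-- ∫_0^1 1[z<t] h_{j,m}(t) dt = |[z,1)∩[l,mid)| − |[z,1)∩[mid,r)|
intIndHaar : ℕ → ℕ → ℚ → ℚ
intIndHaar j m z = len∩ z 1ℚ (hl j m) (hm j m) - len∩ z 1ℚ (hm j m) (hr j m)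

-- ∫_u^v t dt = (v² − u²)/2
intId : ℚ → ℚ → ℚ
intId u v = ½ * (v * v - u * u)

-- ∫_0^1 t h_{j,m}(t) dt
intIdHaar : ℕ → ℕ → ℚ
intIdHaar j m = intId (hl j m) (hm j m) - intId (hm j m) (hr j m)

haarCoeff : List (ℚ × ℚ) → ℕ → ℕ → ℕ → ℕ → ℚ
haarCoeff P j₁ j₂ m₁ m₂ =
  inv (length P) *
    sumList (map (λ z → intIndHaar j₁ m₁ (proj₁ z) * intIndHaar j₂ m₂ (proj₂ z)) P)
  - intIdHaar j₁ m₁ * intIdHaar j₂ m₂

inJ9 : ℕ → ℕ → ℕ → Bool
inJ9 n j₁ j₂ = ⌊ j₁ ℕ.+ j₂ ℕ.≤? n ∸ 2 ⌋ ∧ ⌊ 1 ℕ.≤? j₁ ⌋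

-- Σ_{j∈J₉} 2^{j₁+j₂} Σ_{m₁<2^{j₁}} Σ_{m₂<2^{j₂}} |μ_{j,m}|²
-- (j₁, j₂ range over 0..n, which contains J₉, filtered by inJ9)
lhs9 : (n : ℕ) → (Fin (n ∸ 1) → Bool) → (Fin n → Bool) → ℚ
lhs9 n a σ =
  Σ< (suc n) λ j₁ → Σ< (suc n) λ j₂ →
    if inJ9 n j₁ j₂
    then ℕ→ℚ (2 ℕ.^ (j₁ ℕ.+ j₂)) *
         (Σ< (2 ℕ.^ j₁) λ m₁ → Σ< (2 ℕ.^ j₂) λ m₂ →
            ∣ haarCoeff (pointSet n a σ) j₁ j₂ m₁ m₂ ∣ ^ℚ 2)
    else 0ℚ

rhs9 : ℕ → ℚ
rhs9 n = (+ 1 / 9) * ((+ 1 / 4) ^ℚ (2 ℕ.* n ℕ.+ 3)) *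
         (ℕ→ℚ 3 * ℕ→ℚ n * ((ℕ→ℚ 4) ^ℚ n) - ℕ→ℚ 7 * ((ℕ→ℚ 4) ^ℚ n) + ℕ→ℚ 16)

-- For (j₁, j₂) ∈ J₉ every Haar coefficient has |μ| = 2^(-2n-2), so the left-hand side is
-- 4^(-2n-2) Σ_{J₉} 4^(j₁+j₂), a sum of geometric sums.
--
-- Scaled by 2ⁿ, the point with digits t is (X, Y), where X reads t₁ … tₙ from the least
-- significant end and Y reads b₁ … bₙ from the most significant end. Then ∫ 1[x < t] h_{j,m}(t) dt
-- is -2^(-n) times a tent in X of half-width 2^(n-j-1), and ∫ t h_{j,m}(t) dt = -4^(-j-1). The sum
-- over t of the product of the two tents is computed by splitting off t₁, which is at once the
-- lowest digit of X and, through b₁, the top digit of Y: the x-tent becomes twice the coarser tent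
-- plus t₁ times a coarser Haar function, while the y-tent either keeps one half of its support
-- (j₂ > 0) or becomes affine in the remaining digits (j₂ = 0). Since j₁ ≥ 1, the digit tₙ entering
-- every b_k is constant on the support of the x-Haar function, so the Haar terms cancel except the
-- one paired with the linear part of the y-tent, which contributes ±2^(n-2). The main term
-- 2ⁿ 4^(n-2-j₁-j₂) cancels the product of the integrals ∫ t h, leaving μ = ±2^(-2n-2).

module Submission where

open import Defs

module Bits where

  open import Data.Bool using (Bool; true; false; _xor_; _∧_)
  open import Data.Nat as ℕ using (ℕ; zero; suc; _<_; _^_; z≤n; s≤s)
  import Data.Nat.Properties as ℕₚ
  open import Data.Nat.Tactic.RingSolver using (solve-∀)
  open import Data.Integer using (ℤ; +_; 0ℤ; 1ℤ; -1ℤ; _+_; _*_)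
  import Data.Integer.Properties as ℤₚ
  import Data.Integer.Tactic.RingSolver as ℤ-Solver
  open import Data.Fin using (zero; suc; fromℕ)
  open import Data.Vec.Functional using (Vector; []; _∷_; head; tail; last)
  open import Data.Product using (∃; ∃₂; _×_; _,_)
  open import Relation.Binary.PropositionalEquality
  open import Relation.Nullary using (yes; no; contradiction)
  open import Function using (_∘′_)

  bitℕ : Bool → ℕ
  bitℕ false = 0
  bitℕ true  = 1

  bitℕ≤1 : ∀ b → bitℕ b ℕ.≤ 1
  bitℕ≤1 false = z≤n
  bitℕ≤1 true  = s≤s z≤n

  sgn : Bool → ℤ
  sgn false = 1ℤ
  sgn true  = -1ℤ

  sgn-xor : ∀ b c → sgn (b xor c) ≡ sgn b * sgn c
  sgn-xor false c     = sym (ℤₚ.*-identityˡ (sgn c))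
  sgn-xor true  false = refl
  sgn-xor true  true  = refl

  δ : ℕ → ℕ → ℤ
  δ x y with x ℕ.≟ y
  ... | yes _ = 1ℤ
  ... | no  _ = 0ℤ

  δ-refl : ∀ x → δ x x ≡ 1ℤ
  δ-refl x with x ℕ.≟ x
  ... | yes _   = refl
  ... | no  x≢x = contradiction refl x≢x

  δ-≢ : ∀ {x y} → x ≢ y → δ x y ≡ 0ℤ
  δ-≢ {x} {y} x≢y with x ℕ.≟ y
  ... | yes x≡y = contradiction x≡y x≢y
  ... | no  _   = refl

  δ-cancel : ∀ c x y → δ (c ℕ.+ 2 ℕ.* x) (c ℕ.+ 2 ℕ.* y) ≡ δ x y
  δ-cancel c x y with x ℕ.≟ y
  ... | yes refl = δ-refl (c ℕ.+ 2 ℕ.* x)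
  ... | no  x≢y  = δ-≢ (x≢y ∘′ ℕₚ.*-cancelˡ-≡ x y 2 ∘′ ℕₚ.+-cancelˡ-≡ c _ _)

  δ-double : ∀ d b x y → δ (bitℕ d ℕ.+ 2 ℕ.* x) (bitℕ b ℕ.+ 2 ℕ.* y) ≡ δ (bitℕ d) (bitℕ b) * δ x y
  δ-double false true  x y = δ-≢ (ℕₚ.even≢odd x y)
  δ-double true  false x y = δ-≢ (ℕₚ.even≢odd y x ∘′ sym)
  δ-double false false x y = trans (δ-cancel 0 x y) (sym (ℤₚ.*-identityˡ (δ x y)))
  δ-double true  true  x y = trans (δ-cancel 1 x y) (sym (ℤₚ.*-identityˡ (δ x y)))

  Σbits : ∀ k → (Vector Bool k → ℤ) → ℤ
  Σbits zero    F = F []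
  Σbits (suc k) F = Σbits k (λ t → F (false ∷ t) + F (true ∷ t))

  Σbits-cong : ∀ k {F G : Vector Bool k → ℤ} → (∀ t → F t ≡ G t) → Σbits k F ≡ Σbits k G
  Σbits-cong zero    F≗G = F≗G []
  Σbits-cong (suc k) F≗G = Σbits-cong k (λ t → cong₂ _+_ (F≗G (false ∷ t)) (F≗G (true ∷ t)))

  Σbits-zero : ∀ k → Σbits k (λ _ → 0ℤ) ≡ 0ℤ
  Σbits-zero zero    = refl
  Σbits-zero (suc k) = Σbits-zero k

  Σbits-+ : ∀ k (F G : Vector Bool k → ℤ) → Σbits k (λ t → F t + G t) ≡ Σbits k F + Σbits k G
  Σbits-+ zero    F G = refl
  Σbits-+ (suc k) F G =
    trans (Σbits-cong k (λ t → interchange (F (false ∷ t)) (G (false ∷ t)) (F (true ∷ t)) (G (true ∷ t))))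
          (Σbits-+ k _ _)
    where
    interchange : ∀ a b c d → (a + b) + (c + d) ≡ (a + c) + (b + d)
    interchange = ℤ-Solver.solve-∀

  Σbits-*ˡ : ∀ k c (F : Vector Bool k → ℤ) → Σbits k (λ t → c * F t) ≡ c * Σbits k F
  Σbits-*ˡ zero    c F = refl
  Σbits-*ˡ (suc k) c F =
    trans (Σbits-cong k (λ t → sym (ℤₚ.*-distribˡ-+ c (F (false ∷ t)) (F (true ∷ t))))) (Σbits-*ˡ k c _)

  -- xInt t / 2ⁿ and yInt a σ t / 2ⁿ are the coordinates of the point of P_a(σ) with digits t.
  xInt : ∀ {k} → Vector Bool k → ℕ
  xInt {zero}  t = 0
  xInt {suc k} t = bitℕ (head t) ℕ.+ 2 ℕ.* xInt (tail t)

  yInt : ∀ {m} → Vector Bool m → Vector Bool (suc m) → Vector Bool (suc m) → ℕ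
  yInt {zero}  a σ t = bitℕ (head t xor head σ)
  yInt {suc m} a σ t =
    bitℕ (head t xor ((head a ∧ last t) xor head σ)) ℕ.* 2 ^ suc m ℕ.+ yInt (tail a) (tail σ) (tail t)

  xInt-cong : ∀ {k} {t u : Vector Bool k} → t ≗ u → xInt t ≡ xInt u
  xInt-cong {zero}  t≗u = refl
  xInt-cong {suc k} t≗u = cong₂ (λ b x → bitℕ b ℕ.+ 2 ℕ.* x) (t≗u zero) (xInt-cong (λ i → t≗u (suc i)))

  yInt-cong : ∀ {m} (a : Vector Bool m) σ {t u} → t ≗ u → yInt a σ t ≡ yInt a σ u
  yInt-cong {zero}  a σ t≗u = cong (λ b → bitℕ (b xor head σ)) (t≗u zero)
  yInt-cong {suc m} a σ t≗u =
    cong₂ ℕ._+_ (cong₂ (λ b l → bitℕ (b xor ((head a ∧ l) xor head σ)) ℕ.* 2 ^ suc m) (t≗u zero) (t≗u (fromℕ (suc m))))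
                (yInt-cong (tail a) (tail σ) (λ i → t≗u (suc i)))

  yInt<2^ : ∀ {m} (a : Vector Bool m) σ t → yInt a σ t < 2 ^ suc m
  yInt<2^ {zero}  a σ t = s≤s (bitℕ≤1 _)
  yInt<2^ {suc m} a σ t = begin-strict
    bitℕ b ℕ.* 2 ^ suc m ℕ.+ yInt (tail a) (tail σ) (tail t) <⟨ ℕₚ.+-monoʳ-< _ (yInt<2^ (tail a) (tail σ) (tail t)) ⟩
    bitℕ b ℕ.* 2 ^ suc m ℕ.+ 2 ^ suc m                          ≤⟨ ℕₚ.+-monoˡ-≤ (2 ^ suc m)
                                                                      (ℕₚ.*-monoˡ-≤ (2 ^ suc m) (bitℕ≤1 b)) ⟩
    1 ℕ.* 2 ^ suc m ℕ.+ 2 ^ suc m                               ≡⟨ double (2 ^ suc m) ⟩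
    2 ^ suc (suc m)                                             ∎
    where
    open ℕₚ.≤-Reasoning
    b : Bool
    b = head t xor ((head a ∧ last t) xor head σ)
    double : ∀ x → 1 ℕ.* x ℕ.+ x ≡ 2 ℕ.* x
    double = solve-∀

  halve : ∀ m → ∃₂ λ b h → m ≡ bitℕ b ℕ.+ 2 ℕ.* h
  halve zero          = false , 0 , refl
  halve (suc zero)    = true , 0 , refl
  halve (suc (suc m)) with halve m
  ... | b , h , refl = b , suc h , step (bitℕ b) h
    where
    step : ∀ c h → suc (suc (c ℕ.+ 2 ℕ.* h)) ≡ c ℕ.+ 2 ℕ.* suc h
    step = solve-∀

  halve-< : ∀ k b h → bitℕ b ℕ.+ 2 ℕ.* h < 2 ^ suc k → h < 2 ^ k
  halve-< k b h lt = ℕₚ.*-cancelˡ-< 2 h (2 ^ k) (ℕₚ.≤-<-trans (ℕₚ.m≤n+m (2 ℕ.* h) (bitℕ b)) lt)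

  topDigit : ∀ j m → m < 2 ^ suc j → ∃₂ λ c m′ → m′ < 2 ^ j × m ≡ bitℕ c ℕ.* 2 ^ j ℕ.+ m′
  topDigit j m m<2^j+1 with m ℕ.<? 2 ^ j
  ... | yes m<2^j = false , m , m<2^j , refl
  ... | no  m≮2^j = true , m ℕ.∸ 2 ^ j , m∸2^j<2^j ,
                    sym (trans (cong (ℕ._+ (m ℕ.∸ 2 ^ j)) (ℕₚ.*-identityˡ (2 ^ j))) (ℕₚ.m+[n∸m]≡n 2^j≤m))
    where
    2^j≤m : 2 ^ j ℕ.≤ m
    2^j≤m = ℕₚ.≮⇒≥ m≮2^j
    m∸2^j<2^j : m ℕ.∸ 2 ^ j < 2 ^ j
    m∸2^j<2^j = ℕₚ.+-cancelˡ-< (2 ^ j) _ _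
      (subst₂ _<_ (sym (ℕₚ.m+[n∸m]≡n 2^j≤m)) (cong (λ x → 2 ^ j ℕ.+ x) (ℕₚ.+-identityʳ (2 ^ j))) m<2^j+1)

  Σbits-δ-xInt : ∀ k m (g : Vector Bool k → ℤ) → m < 2 ^ k →
                 ∃ λ s → Σbits k (λ t → δ (xInt t) m * g t) ≡ g s
  Σbits-δ-xInt zero    zero    g _        = [] , ℤₚ.*-identityˡ (g [])
  Σbits-δ-xInt zero    (suc m) g (s≤s ())
  Σbits-δ-xInt (suc k) m       g m<2^k+1 with halve m
  ... | b , h , refl with Σbits-δ-xInt k h (λ t → g (b ∷ t)) (halve-< k b h m<2^k+1)
  ...   | s , Σ≡ = b ∷ s , trans (Σbits-cong k select) Σ≡
    where
    select : ∀ t → δ (xInt (false ∷ t)) (bitℕ b ℕ.+ 2 ℕ.* h) * g (false ∷ t)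
                   + δ (xInt (true ∷ t)) (bitℕ b ℕ.+ 2 ℕ.* h) * g (true ∷ t)
                 ≡ δ (xInt t) h * g (b ∷ t)
    select t = trans (cong₂ (λ p q → p * g (false ∷ t) + q * g (true ∷ t))
                            (δ-double false b (xInt t) h) (δ-double true b (xInt t) h))
                     (pick b)
      where
      keepˡ : ∀ x u v → 1ℤ * x * u + 0ℤ * x * v ≡ x * u
      keepˡ = ℤ-Solver.solve-∀
      keepʳ : ∀ x u v → 0ℤ * x * u + 1ℤ * x * v ≡ x * v
      keepʳ = ℤ-Solver.solve-∀

      pick : ∀ b → δ 0 (bitℕ b) * δ (xInt t) h * g (false ∷ t) + δ 1 (bitℕ b) * δ (xInt t) h * g (true ∷ t)
                   ≡ δ (xInt t) h * g (b ∷ t)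
      pick false = keepˡ (δ (xInt t) h) (g (false ∷ t)) (g (true ∷ t))
      pick true  = keepʳ (δ (xInt t) h) (g (false ∷ t)) (g (true ∷ t))

module Hat where

  open Bits
  open import Data.Bool using (true; false)
  open import Data.Nat as ℕ using (ℕ; suc; _+_; _*_; _^_; _<_; _≮_; _≤_; _<?_; z≤n; s≤s)
  import Data.Nat.Properties as ℕₚ
  open import Data.Nat.Tactic.RingSolver using (solve-∀)
  open import Data.Integer as ℤ using (ℤ; +_; 0ℤ; 1ℤ; -1ℤ)
  import Data.Integer.Properties as ℤₚ
  import Data.Integer.Tactic.RingSolver as ℤ-Solver
  open import Relation.Binary.PropositionalEquality
  open import Relation.Binary.Definitions using (tri<; tri≈; tri>)
  open import Relation.Nullary using (yes; no; contradiction)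

  hat : ℕ → ℕ → ℕ → ℤ
  hat L H X with X <? L | X <? L + H | X <? L + H + H
  ... | yes _ | _     | _     = 0ℤ
  ... | no _  | yes _ | _     = + X ℤ.- + L
  ... | no _  | no _  | yes _ = + (L + H + H) ℤ.- + X
  ... | no _  | no _  | no _  = 0ℤ

  haar : ℕ → ℕ → ℕ → ℤ
  haar L H X with X <? L | X <? L + H | X <? L + H + H
  ... | yes _ | _     | _     = 0ℤ
  ... | no _  | yes _ | _     = 1ℤ
  ... | no _  | no _  | yes _ = -1ℤ
  ... | no _  | no _  | no _  = 0ℤ

  data Position (L H X : ℕ) : Set where
    below : X < L → Position L H X
    left  : ∀ u → u < H → X ≡ L + u → Position L H X
    right : ∀ u → u < H → X ≡ L + H + u → Position L H X
    above : L + H + H ≤ X → Position L H X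

  position : ∀ L H X → Position L H X
  position L H X with X <? L
  ... | yes X<L = below X<L
  ... | no X≮L with X ℕ.∸ L <? H
  ...   | yes u<H = left (X ℕ.∸ L) u<H (sym (ℕₚ.m+[n∸m]≡n (ℕₚ.≮⇒≥ X≮L)))
  ...   | no u≮H with X ℕ.∸ L ℕ.∸ H <? H
  ...     | yes v<H = right (X ℕ.∸ L ℕ.∸ H) v<H (sym L+H+v≡X)
    where
    L+H+v≡X : L + H + (X ℕ.∸ L ℕ.∸ H) ≡ X
    L+H+v≡X = begin
      L + H + (X ℕ.∸ L ℕ.∸ H)     ≡⟨ ℕₚ.+-assoc L H _ ⟩
      L + (H + (X ℕ.∸ L ℕ.∸ H))   ≡⟨ cong (λ v → L + v) (ℕₚ.m+[n∸m]≡n (ℕₚ.≮⇒≥ u≮H)) ⟩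
      L + (X ℕ.∸ L)               ≡⟨ ℕₚ.m+[n∸m]≡n (ℕₚ.≮⇒≥ X≮L) ⟩
      X                           ∎
      where open ≡-Reasoning
  ...     | no v≮H = above (begin
      L + H + H                   ≤⟨ ℕₚ.+-monoʳ-≤ (L + H) (ℕₚ.≮⇒≥ v≮H) ⟩
      L + H + (X ℕ.∸ L ℕ.∸ H)     ≡⟨ ℕₚ.+-assoc L H _ ⟩
      L + (H + (X ℕ.∸ L ℕ.∸ H))   ≡⟨ cong (λ v → L + v) (ℕₚ.m+[n∸m]≡n (ℕₚ.≮⇒≥ u≮H)) ⟩
      L + (X ℕ.∸ L)               ≡⟨ ℕₚ.m+[n∸m]≡n (ℕₚ.≮⇒≥ X≮L) ⟩
      X                           ∎)
    where open ℕₚ.≤-Reasoning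

  private
    L+u≮L : ∀ L u → L + u ≮ L
    L+u≮L L u = ℕₚ.≤⇒≯ (ℕₚ.m≤m+n L u)

    L+H+u≮L : ∀ L H u → L + H + u ≮ L
    L+H+u≮L L H u = ℕₚ.≤⇒≯ (ℕₚ.≤-trans (ℕₚ.m≤m+n L H) (ℕₚ.m≤m+n (L + H) u))

    L+H+u≮L+H : ∀ L H u → L + H + u ≮ L + H
    L+H+u≮L+H L H u = L+u≮L (L + H) u

    R≤X⇒X≮L+H : ∀ {L H X} → L + H + H ≤ X → X ≮ L + H
    R≤X⇒X≮L+H {L} {H} R≤X = ℕₚ.≤⇒≯ (ℕₚ.≤-trans (ℕₚ.m≤m+n (L + H) H) R≤X)

  hat-below : ∀ L H {X} → X < L → hat L H X ≡ 0ℤ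
  hat-below L H {X} X<L with X <? L
  ... | yes _  = refl
  ... | no X≮L = contradiction X<L X≮L

  haar-below : ∀ L H {X} → X < L → haar L H X ≡ 0ℤ
  haar-below L H {X} X<L with X <? L
  ... | yes _  = refl
  ... | no X≮L = contradiction X<L X≮L

  hat-above : ∀ L H {X} → L + H + H ≤ X → hat L H X ≡ 0ℤ
  hat-above L H {X} R≤X with X <? L | X <? L + H | X <? L + H + H
  ... | yes _ | _     | _     = refl
  ... | no _  | yes p | _     = contradiction p (R≤X⇒X≮L+H {L} {H} R≤X)
  ... | no _  | no _  | yes p = contradiction p (ℕₚ.≤⇒≯ R≤X)
  ... | no _  | no _  | no _  = refl

  haar-above : ∀ L H {X} → L + H + H ≤ X → haar L H X ≡ 0ℤ
  haar-above L H {X} R≤X with X <? L | X <? L + H | X <? L + H + H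
  ... | yes _ | _     | _     = refl
  ... | no _  | yes p | _     = contradiction p (R≤X⇒X≮L+H {L} {H} R≤X)
  ... | no _  | no _  | yes p = contradiction p (ℕₚ.≤⇒≯ R≤X)
  ... | no _  | no _  | no _  = refl

  hat-left : ∀ L H {u} → u < H → hat L H (L + u) ≡ + u
  hat-left L H {u} u<H with L + u <? L | L + u <? L + H
  ... | yes p | _     = contradiction p (L+u≮L L u)
  ... | no _  | yes _ = cancel (+ L) (+ u)
    where
    cancel : ∀ l v → (l ℤ.+ v) ℤ.- l ≡ v
    cancel = ℤ-Solver.solve-∀
  ... | no _  | no p  = contradiction (ℕₚ.+-monoʳ-< L u<H) p

  haar-left : ∀ L H {u} → u < H → haar L H (L + u) ≡ 1ℤ
  haar-left L H {u} u<H with L + u <? L | L + u <? L + H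
  ... | yes p | _     = contradiction p (L+u≮L L u)
  ... | no _  | yes _ = refl
  ... | no _  | no p  = contradiction (ℕₚ.+-monoʳ-< L u<H) p

  hat-right : ∀ L H {u} → u < H → hat L H (L + H + u) ≡ + H ℤ.- + u
  hat-right L H {u} u<H with L + H + u <? L | L + H + u <? L + H | L + H + u <? L + H + H
  ... | yes p | _     | _     = contradiction p (L+H+u≮L L H u)
  ... | no _  | yes p | _     = contradiction p (L+H+u≮L+H L H u)
  ... | no _  | no _  | yes _ = cancel (+ (L + H)) (+ H) (+ u)
    where
    cancel : ∀ m h v → (m ℤ.+ h) ℤ.- (m ℤ.+ v) ≡ h ℤ.- v
    cancel = ℤ-Solver.solve-∀
  ... | no _  | no _  | no p  = contradiction (ℕₚ.+-monoʳ-< (L + H) u<H) p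

  haar-right : ∀ L H {u} → u < H → haar L H (L + H + u) ≡ -1ℤ
  haar-right L H {u} u<H with L + H + u <? L | L + H + u <? L + H | L + H + u <? L + H + H
  ... | yes p | _     | _     = contradiction p (L+H+u≮L L H u)
  ... | no _  | yes p | _     = contradiction p (L+H+u≮L+H L H u)
  ... | no _  | no _  | yes _ = refl
  ... | no _  | no _  | no p  = contradiction (ℕₚ.+-monoʳ-< (L + H) u<H) p

  private
    double-< : ∀ d {X L} → X < L → bitℕ d + 2 * X < 2 * L
    double-< d {X} {L} X<L = begin-strict
      bitℕ d + 2 * X   <⟨ s≤s (ℕₚ.+-monoˡ-≤ (2 * X) (bitℕ≤1 d)) ⟩
      2 + 2 * X        ≡⟨ ℕₚ.*-distribˡ-+ 2 1 X ⟨
      2 * suc X        ≤⟨ ℕₚ.*-monoʳ-≤ 2 X<L ⟩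
      2 * L            ∎
      where open ℕₚ.≤-Reasoning

    double-≤ : ∀ d {L H X} → L + H + H ≤ X → 2 * L + 2 * H + 2 * H ≤ bitℕ d + 2 * X
    double-≤ d {L} {H} {X} R≤X = begin
      2 * L + 2 * H + 2 * H   ≡⟨ distrib L H ⟩
      2 * (L + H + H)         ≤⟨ ℕₚ.*-monoʳ-≤ 2 R≤X ⟩
      2 * X                   ≤⟨ ℕₚ.m≤n+m (2 * X) (bitℕ d) ⟩
      bitℕ d + 2 * X          ∎
      where
      open ℕₚ.≤-Reasoning
      distrib : ∀ l h → 2 * l + 2 * h + 2 * h ≡ 2 * (l + h + h)
      distrib = solve-∀

    double-left : ∀ d L u → bitℕ d + 2 * (L + u) ≡ 2 * L + (bitℕ d + 2 * u)
    double-left d L u = regroup (bitℕ d) L u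
      where
      regroup : ∀ b l u → b + 2 * (l + u) ≡ 2 * l + (b + 2 * u)
      regroup = solve-∀

    double-right : ∀ d L H u → bitℕ d + 2 * (L + H + u) ≡ 2 * L + 2 * H + (bitℕ d + 2 * u)
    double-right d L H u = regroup (bitℕ d) L H u
      where
      regroup : ∀ b l h u → b + 2 * (l + h + u) ≡ 2 * l + 2 * h + (b + 2 * u)
      regroup = solve-∀

    combine : ∀ d {x y p q} → x ≡ p → y ≡ q → + 2 ℤ.* x ℤ.+ + bitℕ d ℤ.* y ≡ + 2 ℤ.* p ℤ.+ + bitℕ d ℤ.* q
    combine d = cong₂ (λ p q → + 2 ℤ.* p ℤ.+ + bitℕ d ℤ.* q)

    +bit+2* : ∀ d u → + (bitℕ d + 2 * u) ≡ + bitℕ d ℤ.+ + 2 ℤ.* + u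
    +bit+2* d u = trans (ℤₚ.pos-+ (bitℕ d) (2 * u)) (cong (λ v → + bitℕ d ℤ.+ v) (ℤₚ.pos-* 2 u))

  hat-double : ∀ L H X d → hat (2 * L) (2 * H) (bitℕ d + 2 * X) ≡ + 2 ℤ.* hat L H X ℤ.+ + bitℕ d ℤ.* haar L H X
  hat-double L H X d with position L H X
  ... | below X<L = begin
    hat (2 * L) (2 * H) (bitℕ d + 2 * X)                 ≡⟨ hat-below (2 * L) (2 * H) (double-< d X<L) ⟩
    0ℤ                                                    ≡⟨ vanish (+ bitℕ d) ⟨
    + 2 ℤ.* 0ℤ ℤ.+ + bitℕ d ℤ.* 0ℤ                        ≡⟨ combine d (hat-below L H X<L) (haar-below L H X<L) ⟨
    + 2 ℤ.* hat L H X ℤ.+ + bitℕ d ℤ.* haar L H X         ∎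
    where
    open ≡-Reasoning
    vanish : ∀ b → + 2 ℤ.* 0ℤ ℤ.+ b ℤ.* 0ℤ ≡ 0ℤ
    vanish = ℤ-Solver.solve-∀
  ... | left u u<H refl = begin
    hat (2 * L) (2 * H) (bitℕ d + 2 * (L + u))           ≡⟨ cong (hat (2 * L) (2 * H)) (double-left d L u) ⟩
    hat (2 * L) (2 * H) (2 * L + (bitℕ d + 2 * u))       ≡⟨ hat-left (2 * L) (2 * H) (double-< d u<H) ⟩
    + (bitℕ d + 2 * u)                                    ≡⟨ +bit+2* d u ⟩
    + bitℕ d ℤ.+ + 2 ℤ.* + u                              ≡⟨ regroup (+ bitℕ d) (+ u) ⟩
    + 2 ℤ.* + u ℤ.+ + bitℕ d ℤ.* 1ℤ                       ≡⟨ combine d (hat-left L H u<H) (haar-left L H u<H) ⟨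
    + 2 ℤ.* hat L H (L + u) ℤ.+ + bitℕ d ℤ.* haar L H (L + u) ∎
    where
    open ≡-Reasoning
    regroup : ∀ b v → b ℤ.+ + 2 ℤ.* v ≡ + 2 ℤ.* v ℤ.+ b ℤ.* 1ℤ
    regroup = ℤ-Solver.solve-∀
  ... | right u u<H refl = begin
    hat (2 * L) (2 * H) (bitℕ d + 2 * (L + H + u))       ≡⟨ cong (hat (2 * L) (2 * H)) (double-right d L H u) ⟩
    hat (2 * L) (2 * H) (2 * L + 2 * H + (bitℕ d + 2 * u)) ≡⟨ hat-right (2 * L) (2 * H) (double-< d u<H) ⟩
    + (2 * H) ℤ.- + (bitℕ d + 2 * u)                      ≡⟨ cong₂ ℤ._-_ (ℤₚ.pos-* 2 H) (+bit+2* d u) ⟩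
    + 2 ℤ.* + H ℤ.- (+ bitℕ d ℤ.+ + 2 ℤ.* + u)            ≡⟨ regroup (+ H) (+ u) (+ bitℕ d) ⟩
    + 2 ℤ.* (+ H ℤ.- + u) ℤ.+ + bitℕ d ℤ.* -1ℤ            ≡⟨ combine d (hat-right L H u<H) (haar-right L H u<H) ⟨
    + 2 ℤ.* hat L H (L + H + u) ℤ.+ + bitℕ d ℤ.* haar L H (L + H + u) ∎
    where
    open ≡-Reasoning
    regroup : ∀ h v b → + 2 ℤ.* h ℤ.- (b ℤ.+ + 2 ℤ.* v) ≡ + 2 ℤ.* (h ℤ.- v) ℤ.+ b ℤ.* -1ℤ
    regroup = ℤ-Solver.solve-∀
  ... | above R≤X = begin
    hat (2 * L) (2 * H) (bitℕ d + 2 * X)                 ≡⟨ hat-above (2 * L) (2 * H) (double-≤ d {L} {H} R≤X) ⟩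
    0ℤ                                                    ≡⟨ vanish (+ bitℕ d) ⟨
    + 2 ℤ.* 0ℤ ℤ.+ + bitℕ d ℤ.* 0ℤ                        ≡⟨ combine d (hat-above L H R≤X) (haar-above L H R≤X) ⟨
    + 2 ℤ.* hat L H X ℤ.+ + bitℕ d ℤ.* haar L H X         ∎
    where
    open ≡-Reasoning
    vanish : ∀ b → + 2 ℤ.* 0ℤ ℤ.+ b ℤ.* 0ℤ ≡ 0ℤ
    vanish = ℤ-Solver.solve-∀

  haar-double : ∀ L H X d → haar (2 * L) (2 * H) (bitℕ d + 2 * X) ≡ haar L H X
  haar-double L H X d with position L H X
  ... | below X<L = trans (haar-below (2 * L) (2 * H) (double-< d X<L)) (sym (haar-below L H X<L))
  ... | left u u<H refl =
    trans (cong (haar (2 * L) (2 * H)) (double-left d L u))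
          (trans (haar-left (2 * L) (2 * H) (double-< d u<H)) (sym (haar-left L H u<H)))
  ... | right u u<H refl =
    trans (cong (haar (2 * L) (2 * H)) (double-right d L H u))
          (trans (haar-right (2 * L) (2 * H) (double-< d u<H)) (sym (haar-right L H u<H)))
  ... | above R≤X = trans (haar-above (2 * L) (2 * H) (double-≤ d {L} {H} R≤X)) (sym (haar-above L H R≤X))

  private
    next-≤ : ∀ d {L X} → L < X → 2 * L + 1 + 1 ≤ bitℕ d + 2 * X
    next-≤ d {L} {X} L<X = begin
      2 * L + 1 + 1    ≡⟨ distrib L ⟩
      2 * suc L        ≤⟨ ℕₚ.*-monoʳ-≤ 2 L<X ⟩
      2 * X            ≤⟨ ℕₚ.m≤n+m (2 * X) (bitℕ d) ⟩
      bitℕ d + 2 * X   ∎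
      where
      open ℕₚ.≤-Reasoning
      distrib : ∀ l → 2 * l + 1 + 1 ≡ 2 * suc l
      distrib = solve-∀

    odd-as-right : ∀ X → 1 + 2 * X ≡ 2 * X + 1 + 0
    odd-as-right = solve-∀

  hat-unit : ∀ L X d → hat (2 * L) 1 (bitℕ d + 2 * X) ≡ + bitℕ d ℤ.* δ X L
  hat-unit L X d with ℕₚ.<-cmp X L
  ... | tri< X<L X≢L _ = trans (hat-below (2 * L) 1 (double-< d X<L))
                               (sym (trans (cong (λ z → + bitℕ d ℤ.* z) (δ-≢ X≢L)) (ℤₚ.*-zeroʳ (+ bitℕ d))))
  ... | tri> _ X≢L L<X = trans (hat-above (2 * L) 1 (next-≤ d L<X))
                               (sym (trans (cong (λ z → + bitℕ d ℤ.* z) (δ-≢ X≢L)) (ℤₚ.*-zeroʳ (+ bitℕ d))))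
  hat-unit L X false | tri≈ _ refl _ =
    trans (cong (hat (2 * X) 1) (sym (ℕₚ.+-identityʳ (2 * X))))
          (trans (hat-left (2 * X) 1 (s≤s z≤n)) (cong (λ z → + 0 ℤ.* z) (sym (δ-refl X))))
  hat-unit L X true  | tri≈ _ refl _ =
    trans (cong (hat (2 * X) 1) (odd-as-right X))
          (trans (hat-right (2 * X) 1 (s≤s z≤n)) (cong (λ z → + 1 ℤ.* z) (sym (δ-refl X))))

  haar-unit : ∀ L X d → haar (2 * L) 1 (bitℕ d + 2 * X) ≡ sgn d ℤ.* δ X L
  haar-unit L X d with ℕₚ.<-cmp X L
  ... | tri< X<L X≢L _ = trans (haar-below (2 * L) 1 (double-< d X<L))
                               (sym (trans (cong (λ z → sgn d ℤ.* z) (δ-≢ X≢L)) (ℤₚ.*-zeroʳ (sgn d))))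
  ... | tri> _ X≢L L<X = trans (haar-above (2 * L) 1 (next-≤ d L<X))
                               (sym (trans (cong (λ z → sgn d ℤ.* z) (δ-≢ X≢L)) (ℤₚ.*-zeroʳ (sgn d))))
  haar-unit L X false | tri≈ _ refl _ =
    trans (cong (haar (2 * X) 1) (sym (ℕₚ.+-identityʳ (2 * X))))
          (trans (haar-left (2 * X) 1 (s≤s z≤n)) (cong (λ z → 1ℤ ℤ.* z) (sym (δ-refl X))))
  haar-unit L X true  | tri≈ _ refl _ =
    trans (cong (haar (2 * X) 1) (odd-as-right X))
          (trans (haar-right (2 * X) 1 (s≤s z≤n)) (cong (λ z → -1ℤ ℤ.* z) (sym (δ-refl X))))

  hat-shift : ∀ c L H X → hat (c + L) H (c + X) ≡ hat L H X
  hat-shift c L H X with position L H X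
  ... | below X<L = trans (hat-below (c + L) H (ℕₚ.+-monoʳ-< c X<L)) (sym (hat-below L H X<L))
  ... | left u u<H refl =
    trans (cong (hat (c + L) H) (sym (ℕₚ.+-assoc c L u))) (trans (hat-left (c + L) H u<H) (sym (hat-left L H u<H)))
  ... | right u u<H refl =
    trans (cong (hat (c + L) H) (regroup c L H u)) (trans (hat-right (c + L) H u<H) (sym (hat-right L H u<H)))
    where
    regroup : ∀ c l h u → c + (l + h + u) ≡ c + l + h + u
    regroup = solve-∀
  ... | above R≤X =
    trans (hat-above (c + L) H (ℕₚ.≤-trans (ℕₚ.≤-reflexive (regroup c L H)) (ℕₚ.+-monoʳ-≤ c R≤X))) (sym (hat-above L H R≤X))
    where
    regroup : ∀ c l h → c + l + h + h ≡ c + (l + h + h)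
    regroup = solve-∀

  hat-full : ∀ b {P Y} → Y < P → hat 0 P (bitℕ b * P + Y) ≡ sgn b ℤ.* + Y ℤ.+ + bitℕ b ℤ.* + P
  hat-full false {P} {Y} Y<P = trans (hat-left 0 P Y<P) (regroup (+ Y) (+ P))
    where
    regroup : ∀ y p → y ≡ 1ℤ ℤ.* y ℤ.+ 0ℤ ℤ.* p
    regroup = ℤ-Solver.solve-∀
  hat-full true  {P} {Y} Y<P =
    trans (cong (λ z → hat 0 P (z + Y)) (ℕₚ.+-identityʳ P)) (trans (hat-right 0 P Y<P) (regroup (+ Y) (+ P)))
    where
    regroup : ∀ y p → p ℤ.- y ≡ -1ℤ ℤ.* y ℤ.+ 1ℤ ℤ.* p
    regroup = ℤ-Solver.solve-∀

  dhat dhaar : ℕ → ℕ → ℕ → ℤ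
  dhat  e m = hat  (m * 2 ^ suc e) (2 ^ e)
  dhaar e m = haar (m * 2 ^ suc e) (2 ^ e)

  private
    left-end-suc : ∀ e m → m * 2 ^ suc (suc e) ≡ 2 * (m * 2 ^ suc e)
    left-end-suc e m = regroup m (2 ^ suc e)
      where
      regroup : ∀ m x → m * (2 * x) ≡ 2 * (m * x)
      regroup = solve-∀

  dhat-suc : ∀ e m X d → dhat (suc e) m (bitℕ d + 2 * X) ≡ + 2 ℤ.* dhat e m X ℤ.+ + bitℕ d ℤ.* dhaar e m X
  dhat-suc e m X d = trans (cong (λ L → hat L (2 ^ suc e) (bitℕ d + 2 * X)) (left-end-suc e m)) (hat-double (m * 2 ^ suc e) (2 ^ e) X d)

  dhaar-suc : ∀ e m X d → dhaar (suc e) m (bitℕ d + 2 * X) ≡ dhaar e m X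
  dhaar-suc e m X d = trans (cong (λ L → haar L (2 ^ suc e) (bitℕ d + 2 * X)) (left-end-suc e m)) (haar-double (m * 2 ^ suc e) (2 ^ e) X d)

  dhat-zero : ∀ m X d → dhat 0 m (bitℕ d + 2 * X) ≡ + bitℕ d ℤ.* δ X m
  dhat-zero m X d = trans (cong (λ L → hat L 1 (bitℕ d + 2 * X)) (ℕₚ.*-comm m 2)) (hat-unit m X d)

  dhaar-zero : ∀ m X d → dhaar 0 m (bitℕ d + 2 * X) ≡ sgn d ℤ.* δ X m
  dhaar-zero m X d = trans (cong (λ L → haar L 1 (bitℕ d + 2 * X)) (ℕₚ.*-comm m 2)) (haar-unit m X d)

  dhat-top : ∀ e j c b {m Y} → m < 2 ^ j → Y < 2 ^ (j + suc e) →
             dhat e (bitℕ c * 2 ^ j + m) (bitℕ b * 2 ^ (j + suc e) + Y) ≡ δ (bitℕ b) (bitℕ c) ℤ.* dhat e m Y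
  dhat-top e j false false m<2^j Y<2^j+e+1 = sym (ℤₚ.*-identityˡ _)
  dhat-top e j true  true  {m} {Y} m<2^j Y<2^j+e+1 = begin
    hat ((1 * 2 ^ j + m) * 2 ^ suc e) (2 ^ e) (1 * 2 ^ (j + suc e) + Y)
      ≡⟨ cong₂ (λ L X → hat L (2 ^ e) X) left-end (cong (_+ Y) (ℕₚ.*-identityˡ _)) ⟩
    hat (2 ^ (j + suc e) + m * 2 ^ suc e) (2 ^ e) (2 ^ (j + suc e) + Y)
      ≡⟨ hat-shift (2 ^ (j + suc e)) (m * 2 ^ suc e) (2 ^ e) Y ⟩
    dhat e m Y
      ≡⟨ ℤₚ.*-identityˡ _ ⟨
    1ℤ ℤ.* dhat e m Y ∎
    where
    open ≡-Reasoning
    left-end : (1 * 2 ^ j + m) * 2 ^ suc e ≡ 2 ^ (j + suc e) + m * 2 ^ suc e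
    left-end = trans (ℕₚ.*-distribʳ-+ (2 ^ suc e) (1 * 2 ^ j) m)
                     (cong (_+ m * 2 ^ suc e) (trans (cong (_* 2 ^ suc e) (ℕₚ.*-identityˡ (2 ^ j)))
                                                     (sym (ℕₚ.^-distribˡ-+-* 2 j (suc e)))))
  dhat-top e j true false {m} {Y} m<2^j Y<2^j+e+1 = hat-below _ (2 ^ e) (begin-strict
    Y                                 <⟨ Y<2^j+e+1 ⟩
    2 ^ (j + suc e)                   ≡⟨ ℕₚ.^-distribˡ-+-* 2 j (suc e) ⟩
    2 ^ j * 2 ^ suc e                 ≡⟨ cong (_* 2 ^ suc e) (ℕₚ.*-identityˡ (2 ^ j)) ⟨
    1 * 2 ^ j * 2 ^ suc e             ≤⟨ ℕₚ.*-monoˡ-≤ (2 ^ suc e) (ℕₚ.m≤m+n (1 * 2 ^ j) m) ⟩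
    (1 * 2 ^ j + m) * 2 ^ suc e       ∎)
    where open ℕₚ.≤-Reasoning
  dhat-top e j false true {m} {Y} m<2^j Y<2^j+e+1 = hat-above _ (2 ^ e) (begin
    m * 2 ^ suc e + 2 ^ e + 2 ^ e     ≡⟨ regroup m (2 ^ e) ⟩
    suc m * 2 ^ suc e                 ≤⟨ ℕₚ.*-monoˡ-≤ (2 ^ suc e) m<2^j ⟩
    2 ^ j * 2 ^ suc e                 ≡⟨ ℕₚ.^-distribˡ-+-* 2 j (suc e) ⟨
    2 ^ (j + suc e)                   ≡⟨ ℕₚ.*-identityˡ _ ⟨
    1 * 2 ^ (j + suc e)               ≤⟨ ℕₚ.m≤m+n _ Y ⟩
    1 * 2 ^ (j + suc e) + Y           ∎)
    where
    open ℕₚ.≤-Reasoning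
    regroup : ∀ m x → m * (2 * x) + x + x ≡ suc m * (2 * x)
    regroup = solve-∀

  +[m∸n]≡m-n : ∀ {m n} → n ≤ m → + (m ℕ.∸ n) ≡ + m ℤ.- + n
  +[m∸n]≡m-n {m} {n} n≤m = sym (trans (ℤₚ.m-n≡m⊖n m n) (ℤₚ.⊖-≥ n≤m))

  hat≡overlaps : ∀ L H X → hat L H X ≡ + (L + H + H ℕ.∸ (X ℕ.⊔ (L + H))) ℤ.- + (L + H ℕ.∸ (X ℕ.⊔ L))
  hat≡overlaps L H X with position L H X
  ... | below X<L = sym (begin
    + (R ℕ.∸ (X ℕ.⊔ M)) ℤ.- + (M ℕ.∸ (X ℕ.⊔ L))   ≡⟨ cong₂ (λ p q → + (R ℕ.∸ p) ℤ.- + (M ℕ.∸ q))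
                                                             (ℕₚ.m≤n⇒m⊔n≡n (ℕₚ.≤-trans (ℕₚ.<⇒≤ X<L) (ℕₚ.m≤m+n L H)))
                                                             (ℕₚ.m≤n⇒m⊔n≡n (ℕₚ.<⇒≤ X<L)) ⟩
    + (R ℕ.∸ M) ℤ.- + (M ℕ.∸ L)                   ≡⟨ cong₂ (λ p q → + p ℤ.- + q) (ℕₚ.m+n∸m≡n M H) (ℕₚ.m+n∸m≡n L H) ⟩
    + H ℤ.- + H                                   ≡⟨ ℤₚ.+-inverseʳ (+ H) ⟩
    0ℤ                                            ≡⟨ hat-below L H X<L ⟨
    hat L H X                                     ∎)
    where
    open ≡-Reasoning
    M R : ℕ
    M = L + H
    R = L + H + H
  ... | left u u<H refl = sym (begin
    + (R ℕ.∸ ((L + u) ℕ.⊔ M)) ℤ.- + (M ℕ.∸ ((L + u) ℕ.⊔ L))   ≡⟨ cong₂ (λ p q → + (R ℕ.∸ p) ℤ.- + (M ℕ.∸ q))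
                                                                         (ℕₚ.m≤n⇒m⊔n≡n (ℕₚ.+-monoʳ-≤ L (ℕₚ.<⇒≤ u<H)))
                                                                         (ℕₚ.m≥n⇒m⊔n≡m (ℕₚ.m≤m+n L u)) ⟩
    + (R ℕ.∸ M) ℤ.- + (M ℕ.∸ (L + u))                         ≡⟨ cong₂ (λ p q → + p ℤ.- + q)
                                                                         (ℕₚ.m+n∸m≡n M H) (ℕₚ.[m+n]∸[m+o]≡n∸o L H u) ⟩
    + H ℤ.- + (H ℕ.∸ u)                                       ≡⟨ cong (λ z → + H ℤ.- z) (+[m∸n]≡m-n (ℕₚ.<⇒≤ u<H)) ⟩
    + H ℤ.- (+ H ℤ.- + u)                                     ≡⟨ cancel (+ H) (+ u) ⟩
    + u                                                       ≡⟨ hat-left L H u<H ⟨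
    hat L H (L + u)                                           ∎)
    where
    open ≡-Reasoning
    M R : ℕ
    M = L + H
    R = L + H + H
    cancel : ∀ h v → h ℤ.- (h ℤ.- v) ≡ v
    cancel = ℤ-Solver.solve-∀
  ... | right u u<H refl = sym (begin
    + (R ℕ.∸ ((M + u) ℕ.⊔ M)) ℤ.- + (M ℕ.∸ ((M + u) ℕ.⊔ L))   ≡⟨ cong₂ (λ p q → + (R ℕ.∸ p) ℤ.- + (M ℕ.∸ q))
                                                                         (ℕₚ.m≥n⇒m⊔n≡m M≤M+u)
                                                                         (ℕₚ.m≥n⇒m⊔n≡m (ℕₚ.≤-trans (ℕₚ.m≤m+n L H) M≤M+u)) ⟩
    + (R ℕ.∸ (M + u)) ℤ.- + (M ℕ.∸ (M + u))                   ≡⟨ cong₂ (λ p q → + p ℤ.- + q)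
                                                                         (ℕₚ.[m+n]∸[m+o]≡n∸o M H u) (ℕₚ.m≤n⇒m∸n≡0 M≤M+u) ⟩
    + (H ℕ.∸ u) ℤ.- + 0                                       ≡⟨ ℤₚ.+-identityʳ (+ (H ℕ.∸ u)) ⟩
    + (H ℕ.∸ u)                                               ≡⟨ +[m∸n]≡m-n (ℕₚ.<⇒≤ u<H) ⟩
    + H ℤ.- + u                                               ≡⟨ hat-right L H u<H ⟨
    hat L H (M + u)                                           ∎)
    where
    open ≡-Reasoning
    M R : ℕ
    M = L + H
    R = L + H + H
    M≤M+u : M ≤ M + u
    M≤M+u = ℕₚ.m≤m+n M u
  ... | above R≤X = sym (begin
    + (R ℕ.∸ (X ℕ.⊔ M)) ℤ.- + (M ℕ.∸ (X ℕ.⊔ L))   ≡⟨ cong₂ (λ p q → + (R ℕ.∸ p) ℤ.- + (M ℕ.∸ q))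
                                                             (ℕₚ.m≥n⇒m⊔n≡m M≤X) (ℕₚ.m≥n⇒m⊔n≡m (ℕₚ.≤-trans (ℕₚ.m≤m+n L H) M≤X)) ⟩
    + (R ℕ.∸ X) ℤ.- + (M ℕ.∸ X)                   ≡⟨ cong₂ (λ p q → + p ℤ.- + q) (ℕₚ.m≤n⇒m∸n≡0 R≤X) (ℕₚ.m≤n⇒m∸n≡0 M≤X) ⟩
    0ℤ                                            ≡⟨ hat-above L H R≤X ⟨
    hat L H X                                     ∎)
    where
    open ≡-Reasoning
    M R : ℕ
    M = L + H
    R = L + H + H
    M≤X : M ≤ X
    M≤X = ℕₚ.≤-trans (ℕₚ.m≤m+n M H) R≤X

module DigitSums where

  open Bits
  open Hat
  open import Data.Bool using (Bool; true; false; not; _xor_; _∧_)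
  open import Data.Nat as ℕ using (ℕ; zero; suc; _<_; _^_; s≤s)
  import Data.Nat.Properties as ℕₚ
  open import Data.Nat.Tactic.RingSolver using (solve-∀)
  open import Data.Integer using (ℤ; +_; 0ℤ; 1ℤ; -1ℤ; _+_; _-_; _*_)
  import Data.Integer.Properties as ℤₚ
  import Data.Integer.Tactic.RingSolver as ℤ-Solver
  open import Data.Vec.Functional using (Vector; _∷_; head; tail; last)
  open import Data.Product using (∃; _,_; proj₂; map; map₂)
  open import Relation.Binary.PropositionalEquality

  infix 4 _≡±_
  _≡±_ : ℤ → ℕ → Set
  z ≡± c = ∃ λ s → z ≡ sgn s * + c

  private
    δ-complement : ∀ κ c → δ (bitℕ κ) (bitℕ c) + δ (bitℕ (not κ)) (bitℕ c) ≡ 1ℤ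
    δ-complement false false = refl
    δ-complement false true  = refl
    δ-complement true  false = refl
    δ-complement true  true  = refl

    hat-full-complement : ∀ κ {P Y} → Y < P → hat 0 P (bitℕ κ ℕ.* P ℕ.+ Y) + hat 0 P (bitℕ (not κ) ℕ.* P ℕ.+ Y) ≡ + P
    hat-full-complement κ {P} {Y} Y<P =
      trans (cong₂ _+_ (hat-full κ Y<P) (hat-full (not κ) Y<P)) (collect κ)
      where
      collect : ∀ κ → sgn κ * + Y + + bitℕ κ * + P + (sgn (not κ) * + Y + + bitℕ (not κ) * + P) ≡ + P
      collect false = cancel (+ Y) (+ P)
        where
        cancel : ∀ y p → 1ℤ * y + 0ℤ * p + (-1ℤ * y + 1ℤ * p) ≡ p
        cancel = ℤ-Solver.solve-∀
      collect true  = cancel (+ Y) (+ P)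
        where
        cancel : ∀ y p → -1ℤ * y + 1ℤ * p + (1ℤ * y + 0ℤ * p) ≡ p
        cancel = ℤ-Solver.solve-∀

    digit-difference : ∀ κ P Y → + (bitℕ κ ℕ.* P ℕ.+ Y) - + (bitℕ (not κ) ℕ.* P ℕ.+ Y) ≡ sgn (not κ) * + P
    digit-difference κ P Y =
      trans (cong₂ _-_ (ℤₚ.pos-+ (bitℕ κ ℕ.* P) Y) (ℤₚ.pos-+ (bitℕ (not κ) ℕ.* P) Y))
            (trans (cong₂ (λ u v → u + + Y - (v + + Y)) (ℤₚ.pos-* (bitℕ κ) P) (ℤₚ.pos-* (bitℕ (not κ)) P)) (collect κ))
      where
      collect : ∀ κ → + bitℕ κ * + P + + Y - (+ bitℕ (not κ) * + P + + Y) ≡ sgn (not κ) * + P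
      collect false = cancel (+ P) (+ Y)
        where
        cancel : ∀ p y → 0ℤ * p + y - (1ℤ * p + y) ≡ -1ℤ * p
        cancel = ℤ-Solver.solve-∀
      collect true  = cancel (+ P) (+ Y)
        where
        cancel : ∀ p y → 1ℤ * p + y - (0ℤ * p + y) ≡ 1ℤ * p
        cancel = ℤ-Solver.solve-∀

    digit-sum : ∀ κ P Y → + (bitℕ κ ℕ.* P ℕ.+ Y) + + (bitℕ (not κ) ℕ.* P ℕ.+ Y) ≡ + P + + 2 * + Y
    digit-sum κ P Y =
      trans (sym (ℤₚ.pos-+ (bitℕ κ ℕ.* P ℕ.+ Y) _))
            (trans (cong +_ (collect κ)) (trans (ℤₚ.pos-+ P (2 ℕ.* Y)) (cong (λ z → + P + z) (ℤₚ.pos-* 2 Y))))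
      where
      collect : ∀ κ → bitℕ κ ℕ.* P ℕ.+ Y ℕ.+ (bitℕ (not κ) ℕ.* P ℕ.+ Y) ≡ P ℕ.+ 2 ℕ.* Y
      collect false = regroup P Y
        where
        regroup : ∀ p y → 0 ℕ.* p ℕ.+ y ℕ.+ (1 ℕ.* p ℕ.+ y) ≡ p ℕ.+ 2 ℕ.* y
        regroup = solve-∀
      collect true  = regroup P Y
        where
        regroup : ∀ p y → 1 ℕ.* p ℕ.+ y ℕ.+ (0 ℕ.* p ℕ.+ y) ≡ p ℕ.+ 2 ℕ.* y
        regroup = solve-∀

  Σbits-haar≡0 : ∀ j e m (f : Bool → ℤ) → Σbits (suc (e ℕ.+ suc j)) (λ t → f (last t) * dhaar e m (xInt t)) ≡ 0ℤ
  Σbits-haar≡0 j zero m f = trans (Σbits-cong (suc j) cancel) (Σbits-zero (suc j))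
    where
    opposite : ∀ w x → w * (1ℤ * x) + w * (-1ℤ * x) ≡ 0ℤ
    opposite = ℤ-Solver.solve-∀
    cancel : ∀ t → f (last t) * dhaar 0 m (xInt (false ∷ t)) + f (last t) * dhaar 0 m (xInt (true ∷ t)) ≡ 0ℤ
    cancel t = trans (cong₂ (λ p q → f (last t) * p + f (last t) * q) (dhaar-zero m (xInt t) false) (dhaar-zero m (xInt t) true))
                     (opposite (f (last t)) (δ (xInt t) m))
  Σbits-haar≡0 j (suc e) m f = begin
    Σbits (suc K) (λ t → f (last t) * dhaar (suc e) m (xInt t)) ≡⟨ Σbits-cong K double ⟩
    Σbits K (λ t → + 2 * F t)                                   ≡⟨ Σbits-*ˡ K (+ 2) F ⟩
    + 2 * Σbits K F                                             ≡⟨ cong (λ z → + 2 * z) (Σbits-haar≡0 j e m f) ⟩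
    0ℤ                                                          ∎
    where
    open ≡-Reasoning
    K : ℕ
    K = suc (e ℕ.+ suc j)
    F : Vector Bool K → ℤ
    F t = f (last t) * dhaar e m (xInt t)
    twice : ∀ x → x + x ≡ + 2 * x
    twice = ℤ-Solver.solve-∀
    double : ∀ t → f (last t) * dhaar (suc e) m (xInt (false ∷ t)) + f (last t) * dhaar (suc e) m (xInt (true ∷ t))
                   ≡ + 2 * F t
    double t = trans (cong₂ (λ p q → f (last t) * p + f (last t) * q) (dhaar-suc e m (xInt t) false)
                                                                      (dhaar-suc e m (xInt t) true))
                     (twice (F t))

  Σbits-hat≡4^ : ∀ j e m → m < 2 ^ suc j → Σbits (suc (e ℕ.+ suc j)) (λ t → dhat e m (xInt t)) ≡ + (4 ^ e)
  Σbits-hat≡4^ j zero m m<2^j+1 = begin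
    Σbits (suc (suc j)) (λ t → dhat 0 m (xInt t)) ≡⟨ Σbits-cong (suc j) spike ⟩
    Σbits (suc j) (λ t → δ (xInt t) m * 1ℤ)        ≡⟨ proj₂ (Σbits-δ-xInt (suc j) m (λ _ → 1ℤ) m<2^j+1) ⟩
    1ℤ                                             ∎
    where
    open ≡-Reasoning
    collect : ∀ x → 0ℤ * x + 1ℤ * x ≡ x * 1ℤ
    collect = ℤ-Solver.solve-∀
    spike : ∀ t → dhat 0 m (xInt (false ∷ t)) + dhat 0 m (xInt (true ∷ t)) ≡ δ (xInt t) m * 1ℤ
    spike t = trans (cong₂ _+_ (dhat-zero m (xInt t) false) (dhat-zero m (xInt t) true)) (collect (δ (xInt t) m))
  Σbits-hat≡4^ j (suc e) m m<2^j+1 = begin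
    Σbits (suc K) (λ t → dhat (suc e) m (xInt t))         ≡⟨ Σbits-cong K refine ⟩
    Σbits K (λ t → + 4 * τ t + 1ℤ * η t)                  ≡⟨ Σbits-+ K (λ t → + 4 * τ t) (λ t → 1ℤ * η t) ⟩
    Σbits K (λ t → + 4 * τ t) + Σbits K (λ t → 1ℤ * η t)  ≡⟨ cong₂ _+_ (Σbits-*ˡ K (+ 4) τ) (Σbits-haar≡0 j e m (λ _ → 1ℤ)) ⟩
    + 4 * Σbits K τ + 0ℤ                                  ≡⟨ cong (λ z → + 4 * z + 0ℤ) (Σbits-hat≡4^ j e m m<2^j+1) ⟩
    + 4 * + (4 ^ e) + 0ℤ                                  ≡⟨ trans (ℤₚ.+-identityʳ _) (sym (ℤₚ.pos-* 4 (4 ^ e))) ⟩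
    + (4 ^ suc e)                                         ∎
    where
    open ≡-Reasoning
    K : ℕ
    K = suc (e ℕ.+ suc j)
    τ η : Vector Bool K → ℤ
    τ t = dhat e m (xInt t)
    η t = dhaar e m (xInt t)
    collect : ∀ x y → (+ 2 * x + 0ℤ * y) + (+ 2 * x + 1ℤ * y) ≡ + 4 * x + 1ℤ * y
    collect = ℤ-Solver.solve-∀
    refine : ∀ t → dhat (suc e) m (xInt (false ∷ t)) + dhat (suc e) m (xInt (true ∷ t)) ≡ + 4 * τ t + 1ℤ * η t
    refine t = trans (cong₂ _+_ (dhat-suc e m (xInt t) false) (dhat-suc e m (xInt t) true)) (collect (τ t) (η t))

  Σbits-haar*y≡± : ∀ j e m (g : Bool → Bool) (a : Vector Bool (e ℕ.+ suc j)) σ → m < 2 ^ suc j →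
                Σbits (suc (e ℕ.+ suc j)) (λ t → sgn (g (last t)) * dhaar e m (xInt t) * + yInt a σ t) ≡± 2 ^ (e ℕ.+ suc j)
  Σbits-haar*y≡± j zero m g a σ m<2^j+1 =
    map (λ s → g (last s) xor not (κ s)) (trans (Σbits-cong (suc j) spike)) (Σbits-δ-xInt (suc j) m h m<2^j+1)
    where
    P : ℕ
    P = 2 ^ suc j
    κ : Vector Bool (suc j) → Bool
    κ t = (head a ∧ last t) xor head σ
    Y : Vector Bool (suc j) → ℕ
    Y t = yInt (tail a) (tail σ) t
    h : Vector Bool (suc j) → ℤ
    h t = sgn (g (last t) xor not (κ t)) * + P
    factor : ∀ w x u v → w * (1ℤ * x) * u + w * (-1ℤ * x) * v ≡ x * (w * (u - v))
    factor = ℤ-Solver.solve-∀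
    spike : ∀ t → sgn (g (last t)) * dhaar 0 m (xInt (false ∷ t)) * + yInt a σ (false ∷ t)
                  + sgn (g (last t)) * dhaar 0 m (xInt (true ∷ t)) * + yInt a σ (true ∷ t)
                ≡ δ (xInt t) m * h t
    spike t = begin
      w * dhaar 0 m (xInt (false ∷ t)) * y₀ + w * dhaar 0 m (xInt (true ∷ t)) * y₁
        ≡⟨ cong₂ (λ p q → w * p * y₀ + w * q * y₁) (dhaar-zero m (xInt t) false) (dhaar-zero m (xInt t) true) ⟩
      w * (1ℤ * δₜ) * y₀ + w * (-1ℤ * δₜ) * y₁
        ≡⟨ factor w δₜ y₀ y₁ ⟩
      δₜ * (w * (y₀ - y₁))
        ≡⟨ cong (λ z → δₜ * (w * z)) (digit-difference (κ t) P (Y t)) ⟩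
      δₜ * (w * (sgn (not (κ t)) * + P))
        ≡⟨ cong (δₜ *_) (trans (sym (ℤₚ.*-assoc w (sgn (not (κ t))) (+ P)))
                               (cong (_* + P) (sym (sgn-xor (g (last t)) (not (κ t)))))) ⟩
      δₜ * h t ∎
      where
      open ≡-Reasoning
      w δₜ y₀ y₁ : ℤ
      w  = sgn (g (last t))
      δₜ = δ (xInt t) m
      y₀ = + (bitℕ (κ t) ℕ.* P ℕ.+ Y t)
      y₁ = + (bitℕ (not (κ t)) ℕ.* P ℕ.+ Y t)
  Σbits-haar*y≡± j (suc e) m g a σ m<2^j+1 = map₂ (λ {s} → double s) (Σbits-haar*y≡± j e m g (tail a) (tail σ) m<2^j+1)
    where
    open ≡-Reasoning
    K P : ℕ
    K = suc (e ℕ.+ suc j)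
    P = 2 ^ K
    κ : Vector Bool K → Bool
    κ t = (head a ∧ last t) xor head σ
    Y : Vector Bool K → ℕ
    Y t = yInt (tail a) (tail σ) t
    W : Vector Bool K → ℤ
    W t = sgn (g (last t)) * dhaar e m (xInt t)
    regroup : ∀ p s x → p * 0ℤ + + 2 * (s * x) ≡ s * (+ 2 * x)
    regroup = ℤ-Solver.solve-∀
    distrib : ∀ w u v → w * u + w * v ≡ w * (u + v)
    distrib = ℤ-Solver.solve-∀
    expand : ∀ w p y → w * (p + + 2 * y) ≡ p * w + + 2 * (w * y)
    expand = ℤ-Solver.solve-∀
    split : ∀ t → sgn (g (last t)) * dhaar (suc e) m (xInt (false ∷ t)) * + yInt a σ (false ∷ t)
                  + sgn (g (last t)) * dhaar (suc e) m (xInt (true ∷ t)) * + yInt a σ (true ∷ t)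
                ≡ + P * W t + + 2 * (W t * + Y t)
    split t = begin
      w * dhaar (suc e) m (xInt (false ∷ t)) * y₀ + w * dhaar (suc e) m (xInt (true ∷ t)) * y₁
        ≡⟨ cong₂ (λ p q → w * p * y₀ + w * q * y₁) (dhaar-suc e m (xInt t) false) (dhaar-suc e m (xInt t) true) ⟩
      W t * y₀ + W t * y₁
        ≡⟨ distrib (W t) y₀ y₁ ⟩
      W t * (y₀ + y₁)
        ≡⟨ cong (W t *_) (digit-sum (κ t) P (Y t)) ⟩
      W t * (+ P + + 2 * + Y t)
        ≡⟨ expand (W t) (+ P) (+ Y t) ⟩
      + P * W t + + 2 * (W t * + Y t) ∎
      where
      w y₀ y₁ : ℤ
      w  = sgn (g (last t))
      y₀ = + (bitℕ (κ t) ℕ.* P ℕ.+ Y t)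
      y₁ = + (bitℕ (not (κ t)) ℕ.* P ℕ.+ Y t)
    double : ∀ s → Σbits K (λ t → W t * + Y t) ≡ sgn s * + 2 ^ (e ℕ.+ suc j) →
             Σbits (suc K) (λ t → sgn (g (last t)) * dhaar (suc e) m (xInt t) * + yInt a σ t) ≡ sgn s * + 2 ^ K
    double s Σ≡ = begin
      Σbits (suc K) (λ t → sgn (g (last t)) * dhaar (suc e) m (xInt t) * + yInt a σ t)
        ≡⟨ Σbits-cong K split ⟩
      Σbits K (λ t → + P * W t + + 2 * (W t * + Y t))
        ≡⟨ Σbits-+ K (λ t → + P * W t) (λ t → + 2 * (W t * + Y t)) ⟩
      Σbits K (λ t → + P * W t) + Σbits K (λ t → + 2 * (W t * + Y t))
        ≡⟨ cong₂ _+_ (Σbits-*ˡ K (+ P) W) (Σbits-*ˡ K (+ 2) (λ t → W t * + Y t)) ⟩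
      + P * Σbits K W + + 2 * Σbits K (λ t → W t * + Y t)
        ≡⟨ cong₂ (λ u v → + P * u + + 2 * v) (Σbits-haar≡0 j e m (λ l → sgn (g l))) Σ≡ ⟩
      + P * 0ℤ + + 2 * (sgn s * + 2 ^ (e ℕ.+ suc j))
        ≡⟨ regroup (+ P) (sgn s) (+ 2 ^ (e ℕ.+ suc j)) ⟩
      sgn s * (+ 2 * + 2 ^ (e ℕ.+ suc j))
        ≡⟨ cong (λ z → sgn s * z) (sym (ℤₚ.pos-* 2 (2 ^ (e ℕ.+ suc j)))) ⟩
      sgn s * + 2 ^ K ∎

  -- From here on n = j₂ + r + j + 3, with x-level j₁ = j + 1 and y-level j₂, so r = n - 2 - j₁ - j₂.

  private
    exponent : ∀ j₂ r j → suc (j₂ ℕ.+ suc r ℕ.+ suc j) ≡ j₂ ℕ.+ suc (suc r ℕ.+ suc j)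
    exponent = solve-∀

    dhat-yTop : ∀ j₂ r j c b {m Y} → m < 2 ^ j₂ → Y < 2 ^ suc (j₂ ℕ.+ suc r ℕ.+ suc j) →
                dhat (suc r ℕ.+ suc j) (bitℕ c ℕ.* 2 ^ j₂ ℕ.+ m) (bitℕ b ℕ.* 2 ^ suc (j₂ ℕ.+ suc r ℕ.+ suc j) ℕ.+ Y)
                ≡ δ (bitℕ b) (bitℕ c) * dhat (suc r ℕ.+ suc j) m Y
    dhat-yTop j₂ r j c b {m} {Y} m<2^j₂ Y<2^K =
      trans (cong (λ k → dhat (suc r ℕ.+ suc j) (bitℕ c ℕ.* 2 ^ j₂ ℕ.+ m) (bitℕ b ℕ.* 2 ^ k ℕ.+ Y)) (exponent j₂ r j))
            (dhat-top (suc r ℕ.+ suc j) j₂ c b m<2^j₂ (subst (λ k → Y < 2 ^ k) (exponent j₂ r j) Y<2^K))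

  Σbits-haar*hat≡0 : ∀ j₂ r j m₁ m₂ (f : Bool → ℤ) (a : Vector Bool (j₂ ℕ.+ suc r ℕ.+ suc j)) σ → m₂ < 2 ^ j₂ →
               Σbits (suc (j₂ ℕ.+ suc r ℕ.+ suc j))
                     (λ t → f (last t) * dhaar (j₂ ℕ.+ suc r) m₁ (xInt t) * dhat (suc r ℕ.+ suc j) m₂ (yInt a σ t))
               ≡ 0ℤ
  Σbits-haar*hat≡0 zero r j m₁ (suc m₂) f a σ (s≤s ())
  Σbits-haar*hat≡0 zero r j m₁ zero f a σ _ = begin
    Σbits (suc K) (λ t → f (last t) * dhaar (suc r) m₁ (xInt t) * hat 0 P (yInt a σ t)) ≡⟨ Σbits-cong K collapse ⟩
    Σbits K (λ t → + P * F t)                                                         ≡⟨ Σbits-*ˡ K (+ P) F ⟩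
    + P * Σbits K F                                                                   ≡⟨ cong (λ z → + P * z) (Σbits-haar≡0 j r m₁ f) ⟩
    + P * 0ℤ                                                                          ≡⟨ ℤₚ.*-zeroʳ (+ P) ⟩
    0ℤ                                                                                ∎
    where
    open ≡-Reasoning
    K P : ℕ
    K = suc (r ℕ.+ suc j)
    P = 2 ^ K
    F : Vector Bool K → ℤ
    F t = f (last t) * dhaar r m₁ (xInt t)
    κ : Vector Bool K → Bool
    κ t = (head a ∧ last t) xor head σ
    Y : Vector Bool K → ℕ
    Y t = yInt (tail a) (tail σ) t
    factor : ∀ w u v → w * u + w * v ≡ w * (u + v)
    factor = ℤ-Solver.solve-∀
    collapse : ∀ t → f (last t) * dhaar (suc r) m₁ (xInt (false ∷ t)) * hat 0 P (yInt a σ (false ∷ t))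
                     + f (last t) * dhaar (suc r) m₁ (xInt (true ∷ t)) * hat 0 P (yInt a σ (true ∷ t))
                   ≡ + P * F t
    collapse t = begin
      w * dhaar (suc r) m₁ (xInt (false ∷ t)) * h₀ + w * dhaar (suc r) m₁ (xInt (true ∷ t)) * h₁
        ≡⟨ cong₂ (λ p q → w * p * h₀ + w * q * h₁) (dhaar-suc r m₁ (xInt t) false) (dhaar-suc r m₁ (xInt t) true) ⟩
      F t * h₀ + F t * h₁
        ≡⟨ factor (F t) h₀ h₁ ⟩
      F t * (h₀ + h₁)
        ≡⟨ cong (F t *_) (hat-full-complement (κ t) (yInt<2^ (tail a) (tail σ) t)) ⟩
      F t * + P
        ≡⟨ ℤₚ.*-comm (F t) (+ P) ⟩
      + P * F t ∎
      where
      w h₀ h₁ : ℤ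
      w  = f (last t)
      h₀ = hat 0 P (bitℕ (κ t) ℕ.* P ℕ.+ Y t)
      h₁ = hat 0 P (bitℕ (not (κ t)) ℕ.* P ℕ.+ Y t)
  Σbits-haar*hat≡0 (suc j₂) r j m₁ m₂ f a σ m₂<2^j₂+1 with topDigit j₂ m₂ m₂<2^j₂+1
  ... | c , m₂′ , m₂′<2^j₂ , refl =
    trans (Σbits-cong K select) (Σbits-haar*hat≡0 j₂ r j m₁ m₂′ f (tail a) (tail σ) m₂′<2^j₂)
    where
    K e : ℕ
    K = suc (j₂ ℕ.+ suc r ℕ.+ suc j)
    e = suc r ℕ.+ suc j
    κ : Vector Bool K → Bool
    κ t = (head a ∧ last t) xor head σ
    Y : Vector Bool K → ℕ
    Y t = yInt (tail a) (tail σ) t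
    M : ℕ
    M = bitℕ c ℕ.* 2 ^ j₂ ℕ.+ m₂′
    factor : ∀ w x d d′ y → w * x * (d * y) + w * x * (d′ * y) ≡ (d + d′) * (w * x * y)
    factor = ℤ-Solver.solve-∀
    select : ∀ t → f (last t) * dhaar (suc (j₂ ℕ.+ suc r)) m₁ (xInt (false ∷ t)) * dhat e M (yInt a σ (false ∷ t))
                   + f (last t) * dhaar (suc (j₂ ℕ.+ suc r)) m₁ (xInt (true ∷ t)) * dhat e M (yInt a σ (true ∷ t))
                 ≡ f (last t) * dhaar (j₂ ℕ.+ suc r) m₁ (xInt t) * dhat e m₂′ (Y t)
    select t = begin
      w * dhaar (suc (j₂ ℕ.+ suc r)) m₁ (xInt (false ∷ t)) * dhat e M (yInt a σ (false ∷ t))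
        + w * dhaar (suc (j₂ ℕ.+ suc r)) m₁ (xInt (true ∷ t)) * dhat e M (yInt a σ (true ∷ t))
          ≡⟨ cong₂ _+_ (cong₂ (λ p q → w * p * q) (dhaar-suc (j₂ ℕ.+ suc r) m₁ (xInt t) false)
                                                 (dhat-yTop j₂ r j c (κ t) m₂′<2^j₂ (yInt<2^ (tail a) (tail σ) t)))
                       (cong₂ (λ p q → w * p * q) (dhaar-suc (j₂ ℕ.+ suc r) m₁ (xInt t) true)
                                                 (dhat-yTop j₂ r j c (not (κ t)) m₂′<2^j₂ (yInt<2^ (tail a) (tail σ) t))) ⟩
      w * η * (δ₀ * τʸ) + w * η * (δ₁ * τʸ)  ≡⟨ factor w η δ₀ δ₁ τʸ ⟩
      (δ₀ + δ₁) * (w * η * τʸ)              ≡⟨ cong (_* (w * η * τʸ)) (δ-complement (κ t) c) ⟩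
      1ℤ * (w * η * τʸ)                     ≡⟨ ℤₚ.*-identityˡ (w * η * τʸ) ⟩
      w * η * τʸ                            ∎
      where
      open ≡-Reasoning
      w η τʸ δ₀ δ₁ : ℤ
      w  = f (last t)
      η  = dhaar (j₂ ℕ.+ suc r) m₁ (xInt t)
      τʸ = dhat e m₂′ (Y t)
      δ₀ = δ (bitℕ (κ t)) (bitℕ c)
      δ₁ = δ (bitℕ (not (κ t))) (bitℕ c)

  Σbits-hat*hat : ∀ j₂ r j m₁ m₂ (a : Vector Bool (j₂ ℕ.+ suc r ℕ.+ suc j)) σ → m₁ < 2 ^ suc j → m₂ < 2 ^ j₂ →
              ∃ λ s → Σbits (suc (j₂ ℕ.+ suc r ℕ.+ suc j))
                            (λ t → dhat (j₂ ℕ.+ suc r) m₁ (xInt t) * dhat (suc r ℕ.+ suc j) m₂ (yInt a σ t))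
                      ≡ + (2 ^ suc (j₂ ℕ.+ suc r ℕ.+ suc j) ℕ.* 4 ^ r) + sgn s * + 2 ^ (j₂ ℕ.+ (r ℕ.+ suc j))
  Σbits-hat*hat zero r j m₁ (suc m₂) a σ _ (s≤s ())
  Σbits-hat*hat zero r j m₁ zero a σ m₁<2^j+1 _ =
    map₂ (λ {s} → combine s) (Σbits-haar*y≡± j r m₁ (λ l → not ((head a ∧ l) xor head σ)) (tail a) (tail σ) m₁<2^j+1)
    where
    open ≡-Reasoning
    K P : ℕ
    K = suc (r ℕ.+ suc j)
    P = 2 ^ K
    κ : Vector Bool K → Bool
    κ t = (head a ∧ last t) xor head σ
    Y : Vector Bool K → ℕ
    Y t = yInt (tail a) (tail σ) t
    τ η V W : Vector Bool K → ℤ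
    τ t = dhat r m₁ (xInt t)
    η t = dhaar r m₁ (xInt t)
    V t = sgn (not (κ t)) * η t * + Y t
    W t = + bitℕ (not (κ t)) * η t
    hf : Bool → Vector Bool K → ℤ
    hf c t = hat 0 P (bitℕ c ℕ.* P ℕ.+ Y t)
    separate : ∀ τ η u v → (+ 2 * τ + 0ℤ * η) * u + (+ 2 * τ + 1ℤ * η) * v ≡ + 2 * τ * (u + v) + η * v
    separate = ℤ-Solver.solve-∀
    regroup : ∀ τ η p s w y → + 2 * τ * p + η * (s * y + w * p) ≡ (+ 2 * p) * τ + s * η * y + p * (w * η)
    regroup = ℤ-Solver.solve-∀
    expand : ∀ t → dhat (suc r) m₁ (xInt (false ∷ t)) * hf (κ t) t + dhat (suc r) m₁ (xInt (true ∷ t)) * hf (not (κ t)) t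
                   ≡ (+ 2 * + P) * τ t + V t + + P * W t
    expand t = begin
      dhat (suc r) m₁ (xInt (false ∷ t)) * hf (κ t) t + dhat (suc r) m₁ (xInt (true ∷ t)) * hf (not (κ t)) t
        ≡⟨ cong₂ (λ p q → p * hf (κ t) t + q * hf (not (κ t)) t) (dhat-suc r m₁ (xInt t) false) (dhat-suc r m₁ (xInt t) true) ⟩
      (+ 2 * τ t + 0ℤ * η t) * hf (κ t) t + (+ 2 * τ t + 1ℤ * η t) * hf (not (κ t)) t
        ≡⟨ separate (τ t) (η t) (hf (κ t) t) (hf (not (κ t)) t) ⟩
      + 2 * τ t * (hf (κ t) t + hf (not (κ t)) t) + η t * hf (not (κ t)) t
        ≡⟨ cong₂ (λ u v → + 2 * τ t * u + η t * v) (hat-full-complement (κ t) (yInt<2^ (tail a) (tail σ) t))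
                                                     (hat-full (not (κ t)) (yInt<2^ (tail a) (tail σ) t)) ⟩
      + 2 * τ t * + P + η t * (sgn (not (κ t)) * + Y t + + bitℕ (not (κ t)) * + P)
        ≡⟨ regroup (τ t) (η t) (+ P) (sgn (not (κ t))) (+ bitℕ (not (κ t))) (+ Y t) ⟩
      (+ 2 * + P) * τ t + V t + + P * W t ∎
    combine : ∀ s → Σbits K V ≡ sgn s * + 2 ^ (r ℕ.+ suc j) →
              Σbits (suc K) (λ t → dhat (suc r) m₁ (xInt t) * hat 0 P (yInt a σ t))
              ≡ + (2 ℕ.* P ℕ.* 4 ^ r) + sgn s * + 2 ^ (r ℕ.+ suc j)
    combine s ΣV≡ = begin
      Σbits (suc K) (λ t → dhat (suc r) m₁ (xInt t) * hat 0 P (yInt a σ t))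
        ≡⟨ Σbits-cong K expand ⟩
      Σbits K (λ t → (+ 2 * + P) * τ t + V t + + P * W t)
        ≡⟨ Σbits-+ K (λ t → (+ 2 * + P) * τ t + V t) (λ t → + P * W t) ⟩
      Σbits K (λ t → (+ 2 * + P) * τ t + V t) + Σbits K (λ t → + P * W t)
        ≡⟨ cong (_+ Σbits K (λ t → + P * W t)) (Σbits-+ K (λ t → (+ 2 * + P) * τ t) V) ⟩
      Σbits K (λ t → (+ 2 * + P) * τ t) + Σbits K V + Σbits K (λ t → + P * W t)
        ≡⟨ cong₂ (λ u v → u + Σbits K V + v) (Σbits-*ˡ K (+ 2 * + P) τ) (Σbits-*ˡ K (+ P) W) ⟩
      (+ 2 * + P) * Σbits K τ + Σbits K V + + P * Σbits K W
        ≡⟨ cong₂ (λ u v → (+ 2 * + P) * u + v + + P * Σbits K W) (Σbits-hat≡4^ j r m₁ m₁<2^j+1) ΣV≡ ⟩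
      (+ 2 * + P) * + (4 ^ r) + sgn s * + 2 ^ (r ℕ.+ suc j) + + P * Σbits K W
        ≡⟨ cong (λ z → (+ 2 * + P) * + (4 ^ r) + sgn s * + 2 ^ (r ℕ.+ suc j) + + P * z)
                (Σbits-haar≡0 j r m₁ (λ l → + bitℕ (not ((head a ∧ l) xor head σ)))) ⟩
      (+ 2 * + P) * + (4 ^ r) + sgn s * + 2 ^ (r ℕ.+ suc j) + + P * 0ℤ
        ≡⟨ trans (cong (λ z → (+ 2 * + P) * + (4 ^ r) + sgn s * + 2 ^ (r ℕ.+ suc j) + z) (ℤₚ.*-zeroʳ (+ P)))
                 (ℤₚ.+-identityʳ _) ⟩
      (+ 2 * + P) * + (4 ^ r) + sgn s * + 2 ^ (r ℕ.+ suc j)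
        ≡⟨ cong (λ z → z + sgn s * + 2 ^ (r ℕ.+ suc j))
                (trans (cong (_* + (4 ^ r)) (sym (ℤₚ.pos-* 2 P))) (sym (ℤₚ.pos-* (2 ℕ.* P) (4 ^ r)))) ⟩
      + (2 ℕ.* P ℕ.* 4 ^ r) + sgn s * + 2 ^ (r ℕ.+ suc j) ∎
  Σbits-hat*hat (suc j₂) r j m₁ m₂ a σ m₁<2^j+1 m₂<2^j₂+1 with topDigit j₂ m₂ m₂<2^j₂+1
  ... | c , m₂′ , m₂′<2^j₂ , refl = map₂ (λ {s} → combine s) (Σbits-hat*hat j₂ r j m₁ m₂′ (tail a) (tail σ) m₁<2^j+1 m₂′<2^j₂)
    where
    open ≡-Reasoning
    K e M A B : ℕ
    K = suc (j₂ ℕ.+ suc r ℕ.+ suc j)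
    e = suc r ℕ.+ suc j
    M = bitℕ c ℕ.* 2 ^ j₂ ℕ.+ m₂′
    A = 2 ^ K ℕ.* 4 ^ r
    B = 2 ^ (j₂ ℕ.+ (r ℕ.+ suc j))
    κ : Vector Bool K → Bool
    κ t = (head a ∧ last t) xor head σ
    Y : Vector Bool K → ℕ
    Y t = yInt (tail a) (tail σ) t
    τ η τʸ U V : Vector Bool K → ℤ
    τ t = dhat (j₂ ℕ.+ suc r) m₁ (xInt t)
    η t = dhaar (j₂ ℕ.+ suc r) m₁ (xInt t)
    τʸ t = dhat e m₂′ (Y t)
    U t = τ t * τʸ t
    V t = δ (bitℕ (not (κ t))) (bitℕ c) * η t * τʸ t
    separate : ∀ τ η d d′ u → (+ 2 * τ + 0ℤ * η) * (d * u) + (+ 2 * τ + 1ℤ * η) * (d′ * u)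
                              ≡ + 2 * (τ * u) * (d + d′) + d′ * η * u
    separate = ℤ-Solver.solve-∀
    distribute : ∀ a s b → + 2 * (a + s * b) + 0ℤ ≡ + 2 * a + s * (+ 2 * b)
    distribute = ℤ-Solver.solve-∀
    expand : ∀ t → dhat (suc (j₂ ℕ.+ suc r)) m₁ (xInt (false ∷ t)) * dhat e M (yInt a σ (false ∷ t))
                   + dhat (suc (j₂ ℕ.+ suc r)) m₁ (xInt (true ∷ t)) * dhat e M (yInt a σ (true ∷ t))
                 ≡ + 2 * U t + V t
    expand t = begin
      dhat (suc (j₂ ℕ.+ suc r)) m₁ (xInt (false ∷ t)) * dhat e M (yInt a σ (false ∷ t))
        + dhat (suc (j₂ ℕ.+ suc r)) m₁ (xInt (true ∷ t)) * dhat e M (yInt a σ (true ∷ t))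
          ≡⟨ cong₂ _+_ (cong₂ _*_ (dhat-suc (j₂ ℕ.+ suc r) m₁ (xInt t) false)
                                   (dhat-yTop j₂ r j c (κ t) m₂′<2^j₂ (yInt<2^ (tail a) (tail σ) t)))
                       (cong₂ _*_ (dhat-suc (j₂ ℕ.+ suc r) m₁ (xInt t) true)
                                   (dhat-yTop j₂ r j c (not (κ t)) m₂′<2^j₂ (yInt<2^ (tail a) (tail σ) t))) ⟩
      (+ 2 * τ t + 0ℤ * η t) * (δ₀ * τʸ t) + (+ 2 * τ t + 1ℤ * η t) * (δ₁ * τʸ t)
          ≡⟨ separate (τ t) (η t) δ₀ δ₁ (τʸ t) ⟩
      + 2 * U t * (δ₀ + δ₁) + V t
          ≡⟨ cong (λ z → + 2 * U t * z + V t) (δ-complement (κ t) c) ⟩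
      + 2 * U t * 1ℤ + V t
          ≡⟨ cong (_+ V t) (ℤₚ.*-identityʳ (+ 2 * U t)) ⟩
      + 2 * U t + V t ∎
      where
      δ₀ δ₁ : ℤ
      δ₀ = δ (bitℕ (κ t)) (bitℕ c)
      δ₁ = δ (bitℕ (not (κ t))) (bitℕ c)
    combine : ∀ s → Σbits K U ≡ + A + sgn s * + B →
              Σbits (suc K) (λ t → dhat (suc (j₂ ℕ.+ suc r)) m₁ (xInt t) * dhat e M (yInt a σ t))
              ≡ + (2 ℕ.* 2 ^ K ℕ.* 4 ^ r) + sgn s * + (2 ℕ.* B)
    combine s ΣU≡ = begin
      Σbits (suc K) (λ t → dhat (suc (j₂ ℕ.+ suc r)) m₁ (xInt t) * dhat e M (yInt a σ t))
        ≡⟨ Σbits-cong K expand ⟩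
      Σbits K (λ t → + 2 * U t + V t)
        ≡⟨ Σbits-+ K (λ t → + 2 * U t) V ⟩
      Σbits K (λ t → + 2 * U t) + Σbits K V
        ≡⟨ cong₂ _+_ (Σbits-*ˡ K (+ 2) U)
                     (Σbits-haar*hat≡0 j₂ r j m₁ m₂′ (λ l → δ (bitℕ (not ((head a ∧ l) xor head σ))) (bitℕ c))
                                 (tail a) (tail σ) m₂′<2^j₂) ⟩
      + 2 * Σbits K U + 0ℤ
        ≡⟨ cong (λ z → + 2 * z + 0ℤ) ΣU≡ ⟩
      + 2 * (+ A + sgn s * + B) + 0ℤ
        ≡⟨ distribute (+ A) (sgn s) (+ B) ⟩
      + 2 * + A + sgn s * (+ 2 * + B)
        ≡⟨ cong₂ (λ u v → u + sgn s * v) (trans (sym (ℤₚ.pos-* 2 A)) (cong +_ (sym (ℕₚ.*-assoc 2 (2 ^ K) (4 ^ r)))))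
                                         (sym (ℤₚ.pos-* 2 B)) ⟩
      + (2 ℕ.* 2 ^ K ℕ.* 4 ^ r) + sgn s * + (2 ℕ.* B) ∎

module Dyadic where

  open Bits
  open Hat
  open import Data.Bool using (Bool; true; false; _xor_; _∧_)
  open import Data.Bool.Properties using (xor-assoc)
  open import Data.Maybe using (Maybe; just; nothing)
  open import Data.Vec.Functional using (Vector; _∷_; head; tail; last)
  open import Data.Fin using (zero; suc)
  import Data.List as List
  import Data.List.Properties as ListP
  open import Data.Nat as ℕ using (ℕ; zero; suc; _^_)
  open import Data.Nat.Tactic.RingSolver using (solve-∀)
  import Data.Nat.Properties as ℕₚ
  import Data.Nat.Coprimality as Coprime
  open import Data.Integer as ℤ using (ℤ; +_; 0ℤ)
  import Data.Integer.Properties as ℤₚ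
  import Data.Integer.Tactic.RingSolver as ℤ-Solver
  open import Data.Rational using (ℚ; mkℚ; 0ℚ; 1ℚ; ½; _+_; _*_; _-_; -_; _≤_; _⊔_; _⊓_; NonNegative)
  import Data.Rational.Properties as ℚₚ
  open import Level using (0ℓ)
  open import Relation.Binary.PropositionalEquality
  open import Relation.Nullary using (yes; no)
  open import Data.Sum using (inj₁; inj₂)
  import Tactic.RingSolver as Solver
  import Tactic.RingSolver.Core.AlmostCommutativeRing as ACR

  ℚ-ring : ACR.AlmostCommutativeRing 0ℓ 0ℓ
  ℚ-ring = ACR.fromCommutativeRing ℚₚ.+-*-commutativeRing isZero
    where
    isZero : (x : ℚ) → Maybe (0ℚ ≡ x)
    isZero x with 0ℚ ℚₚ.≟ x
    ... | yes 0≡x = just 0≡x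
    ... | no  _   = nothing

  ι : ℤ → ℚ
  ι z = z Data.Rational./ 1

  private
    ι≡mkℚ : ∀ z → ι z ≡ mkℚ z 0 (Coprime.sym (Coprime.1-coprimeTo ℤ.∣ z ∣))
    ι≡mkℚ z = ℚₚ.↥p/↧p≡p (mkℚ z 0 (Coprime.sym (Coprime.1-coprimeTo ℤ.∣ z ∣)))

  ι-+ : ∀ a b → ι (a ℤ.+ b) ≡ ι a + ι b
  ι-+ a b = sym (trans (cong₂ _+_ (ι≡mkℚ a) (ι≡mkℚ b)) (cong ι (unit a b)))
    where
    unit : ∀ a b → a ℤ.* + 1 ℤ.+ b ℤ.* + 1 ≡ a ℤ.+ b
    unit = ℤ-Solver.solve-∀

  ι-* : ∀ a b → ι (a ℤ.* b) ≡ ι a * ι b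
  ι-* a b = sym (cong₂ _*_ (ι≡mkℚ a) (ι≡mkℚ b))

  ι-neg : ∀ a → ι (ℤ.- a) ≡ - ι a
  ι-neg a = trans (ι≡mkℚ (ℤ.- a)) (sym (trans (cong -_ (ι≡mkℚ a)) (neg-mkℚ a)))
    where
    neg-mkℚ : ∀ a → - mkℚ a 0 (Coprime.sym (Coprime.1-coprimeTo ℤ.∣ a ∣))
                    ≡ mkℚ (ℤ.- a) 0 (Coprime.sym (Coprime.1-coprimeTo ℤ.∣ ℤ.- a ∣))
    neg-mkℚ (+ zero)    = refl
    neg-mkℚ ℤ.+[1+ n ] = refl
    neg-mkℚ ℤ.-[1+ n ] = refl

  ι-mono : ∀ {a b} → a ℤ.≤ b → ι a ≤ ι b
  ι-mono {a} {b} a≤b = subst₂ _≤_ (sym (ι≡mkℚ a)) (sym (ι≡mkℚ b))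
    (Data.Rational.*≤* (subst₂ ℤ._≤_ (sym (ℤₚ.*-identityʳ a)) (sym (ℤₚ.*-identityʳ b)) a≤b))

  2^-‿+ : ∀ a b → 2^- (a ℕ.+ b) ≡ 2^- a * 2^- b
  2^-‿+ zero    b = sym (ℚₚ.*-identityˡ (2^- b))
  2^-‿+ (suc a) b = trans (cong (½ *_) (2^-‿+ a b)) (sym (ℚₚ.*-assoc ½ (2^- a) (2^- b)))

  2^-‿nonNeg : ∀ k → NonNegative (2^- k)
  2^-‿nonNeg zero    = _
  2^-‿nonNeg (suc k) = ℚₚ.nonNeg*nonNeg⇒nonNeg ½ {{_}} (2^- k) {{2^-‿nonNeg k}}

  2^*2^- : ∀ k → ι (+ 2 ^ k) * 2^- k ≡ 1ℚ
  2^*2^- zero    = refl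
  2^*2^- (suc k) = begin
    ι (+ (2 ℕ.* 2 ^ k)) * (½ * 2^- k)         ≡⟨ cong (_* (½ * 2^- k)) (trans (cong ι (ℤₚ.pos-* 2 (2 ^ k))) (ι-* (+ 2) (+ 2 ^ k))) ⟩
    (ι (+ 2) * ι (+ 2 ^ k)) * (½ * 2^- k)     ≡⟨ interchange (ι (+ 2)) (ι (+ 2 ^ k)) ½ (2^- k) ⟩
    (ι (+ 2) * ½) * (ι (+ 2 ^ k) * 2^- k)     ≡⟨ cong ((ι (+ 2) * ½) *_) (2^*2^- k) ⟩
    1ℚ                                        ∎
    where
    open ≡-Reasoning
    interchange : ∀ a b c d → (a * b) * (c * d) ≡ (a * c) * (b * d)
    interchange = Solver.solve-∀ ℚ-ring

  infixl 7.5 _/2^_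
  _/2^_ : ℤ → ℕ → ℚ
  z /2^ k = ι z * 2^- k

  /2^-+ : ∀ k a b → (a ℤ.+ b) /2^ k ≡ a /2^ k + b /2^ k
  /2^-+ k a b = trans (cong (_* 2^- k) (ι-+ a b)) (ℚₚ.*-distribʳ-+ (2^- k) (ι a) (ι b))

  /2^-neg : ∀ k a → (ℤ.- a) /2^ k ≡ - (a /2^ k)
  /2^-neg k a = trans (cong (_* 2^- k) (ι-neg a)) (sym (ℚₚ.neg-distribˡ-* (ι a) (2^- k)))

  /2^-- : ∀ k a b → (a ℤ.- b) /2^ k ≡ a /2^ k - b /2^ k
  /2^-- k a b = trans (/2^-+ k a (ℤ.- b)) (cong (λ w → a /2^ k + w) (/2^-neg k b))

  /2^-mono : ∀ k {a b} → a ℤ.≤ b → a /2^ k ≤ b /2^ k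
  /2^-mono k a≤b = ℚₚ.*-monoʳ-≤-nonNeg (2^- k) {{2^-‿nonNeg k}} (ι-mono a≤b)

  /2^-⊔ : ∀ k a b → (a ℤ.⊔ b) /2^ k ≡ a /2^ k ⊔ b /2^ k
  /2^-⊔ k a b with ℤₚ.≤-total a b
  ... | inj₁ a≤b = trans (cong (λ z → z /2^ k) (ℤₚ.i≤j⇒i⊔j≡j a≤b)) (sym (ℚₚ.p≤q⇒p⊔q≡q (/2^-mono k a≤b)))
  ... | inj₂ b≤a = trans (cong (λ z → z /2^ k) (ℤₚ.i≥j⇒i⊔j≡i b≤a)) (sym (ℚₚ.p≥q⇒p⊔q≡p (/2^-mono k b≤a)))

  /2^-⊓ : ∀ k a b → (a ℤ.⊓ b) /2^ k ≡ a /2^ k ⊓ b /2^ k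
  /2^-⊓ k a b with ℤₚ.≤-total a b
  ... | inj₁ a≤b = trans (cong (λ z → z /2^ k) (ℤₚ.i≤j⇒i⊓j≡i a≤b)) (sym (ℚₚ.p≤q⇒p⊓q≡p (/2^-mono k a≤b)))
  ... | inj₂ b≤a = trans (cong (λ z → z /2^ k) (ℤₚ.i≥j⇒i⊓j≡j b≤a)) (sym (ℚₚ.p≥q⇒p⊓q≡q (/2^-mono k b≤a)))

  /2^-*2^ : ∀ z e k → (z ℤ.* + 2 ^ e) /2^ (e ℕ.+ k) ≡ z /2^ k
  /2^-*2^ z e k = begin
    ι (z ℤ.* + 2 ^ e) * 2^- (e ℕ.+ k)          ≡⟨ cong₂ _*_ (ι-* z (+ 2 ^ e)) (2^-‿+ e k) ⟩
    (ι z * ι (+ 2 ^ e)) * (2^- e * 2^- k)       ≡⟨ regroup (ι z) (ι (+ 2 ^ e)) (2^- e) (2^- k) ⟩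
    ι z * (ι (+ 2 ^ e) * 2^- e) * 2^- k         ≡⟨ cong (λ w → ι z * w * 2^- k) (2^*2^- e) ⟩
    ι z * 1ℚ * 2^- k                            ≡⟨ cong (_* 2^- k) (ℚₚ.*-identityʳ (ι z)) ⟩
    z /2^ k                                     ∎
    where
    open ≡-Reasoning
    regroup : ∀ a b c d → (a * b) * (c * d) ≡ a * (b * c) * d
    regroup = Solver.solve-∀ ℚ-ring

  lenℤ : ℤ → ℤ → ℤ → ℤ → ℤ
  lenℤ u v c d = 0ℤ ℤ.⊔ ((v ℤ.⊓ d) ℤ.- (u ℤ.⊔ c))

  len∩-/2^ : ∀ k u v c d → len∩ (u /2^ k) (v /2^ k) (c /2^ k) (d /2^ k) ≡ lenℤ u v c d /2^ k
  len∩-/2^ k u v c d = begin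
    0ℚ ⊔ ((v /2^ k ⊓ d /2^ k) - (u /2^ k ⊔ c /2^ k))  ≡⟨ cong₂ (λ x y → 0ℚ ⊔ (x - y)) (/2^-⊓ k v d) (/2^-⊔ k u c) ⟨
    0ℚ ⊔ ((v ℤ.⊓ d) /2^ k - (u ℤ.⊔ c) /2^ k)          ≡⟨ cong₂ _⊔_ (ℚₚ.*-zeroˡ (2^- k))
                                                                     (/2^-- k (v ℤ.⊓ d) (u ℤ.⊔ c)) ⟨
    0ℤ /2^ k ⊔ ((v ℤ.⊓ d) ℤ.- (u ℤ.⊔ c)) /2^ k        ≡⟨ /2^-⊔ k 0ℤ ((v ℤ.⊓ d) ℤ.- (u ℤ.⊔ c)) ⟨
    lenℤ u v c d /2^ k                                ∎
    where open ≡-Reasoning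

  private
    0⊔[m-n]≡m∸n : ∀ m n → 0ℤ ℤ.⊔ (+ m ℤ.- + n) ≡ + (m ℕ.∸ n)
    0⊔[m-n]≡m∸n m n with ℕₚ.≤-total n m
    ... | inj₁ n≤m = cong (0ℤ ℤ.⊔_) (trans (ℤₚ.m-n≡m⊖n m n) (ℤₚ.⊖-≥ n≤m))
    ... | inj₂ m≤n = trans (cong (0ℤ ℤ.⊔_) (trans (ℤₚ.m-n≡m⊖n m n) (ℤₚ.⊖-≤ m≤n)))
                           (trans (0⊔-neg (n ℕ.∸ m)) (cong +_ (sym (ℕₚ.m≤n⇒m∸n≡0 m≤n))))
      where
      0⊔-neg : ∀ k → 0ℤ ℤ.⊔ ℤ.- + k ≡ 0ℤ
      0⊔-neg zero    = refl
      0⊔-neg (suc k) = refl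

  lenℤ-ℕ : ∀ X N c d → d ℕ.≤ N → lenℤ (+ X) (+ N) (+ c) (+ d) ≡ + (d ℕ.∸ (X ℕ.⊔ c))
  lenℤ-ℕ X N c d d≤N =
    trans (cong (λ z → 0ℤ ℤ.⊔ (+ z ℤ.- + (X ℕ.⊔ c))) (ℕₚ.m≥n⇒m⊓n≡n d≤N)) (0⊔[m-n]≡m∸n d (X ℕ.⊔ c))

  module _ (e j m : ℕ) where

    private
      n L H : ℕ
      n = suc (e ℕ.+ j)
      L = m ℕ.* 2 ^ suc e
      H = 2 ^ e

    hl≡ : hl j m ≡ + L /2^ n
    hl≡ = sym (trans (cong (λ z → z /2^ n) (ℤₚ.pos-* m (2 ^ suc e))) (/2^-*2^ (+ m) (suc e) j))

    half-width≡ : 2^- (suc j) ≡ + H /2^ n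
    half-width≡ = sym (begin
      + H /2^ n                          ≡⟨ cong₂ _/2^_ (ℤₚ.*-identityˡ (+ H)) (ℕₚ.+-suc e j) ⟨
      (+ 1 ℤ.* + H) /2^ (e ℕ.+ suc j)   ≡⟨ /2^-*2^ (+ 1) e (suc j) ⟩
      1ℚ * 2^- (suc j)                   ≡⟨ ℚₚ.*-identityˡ (2^- (suc j)) ⟩
      2^- (suc j)                        ∎)
      where open ≡-Reasoning

    hm≡ : hm j m ≡ + (L ℕ.+ H) /2^ n
    hm≡ = trans (cong₂ _+_ hl≡ half-width≡) (sym (trans (cong (λ z → z /2^ n) (ℤₚ.pos-+ L H)) (/2^-+ n (+ L) (+ H))))

    hr≡ : hr j m ≡ + (L ℕ.+ H ℕ.+ H) /2^ n
    hr≡ = sym (begin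
      + (L ℕ.+ H ℕ.+ H) /2^ n                   ≡⟨ cong (λ k → + k /2^ n) (regroup m (2 ^ e)) ⟩
      + (suc m ℕ.* 2 ^ suc e) /2^ n             ≡⟨ cong (λ z → z /2^ n) (ℤₚ.pos-* (suc m) (2 ^ suc e)) ⟩
      (+ suc m ℤ.* + 2 ^ suc e) /2^ (suc e ℕ.+ j) ≡⟨ /2^-*2^ (+ suc m) (suc e) j ⟩
      hr j m                                    ∎)
      where
      open ≡-Reasoning
      regroup : ∀ m h → m ℕ.* (2 ℕ.* h) ℕ.+ h ℕ.+ h ≡ suc m ℕ.* (2 ℕ.* h)
      regroup = solve-∀

    support≤ : m ℕ.< 2 ^ j → L ℕ.+ H ℕ.+ H ℕ.≤ 2 ^ n
    support≤ m<2^j = begin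
      L ℕ.+ H ℕ.+ H                ≡⟨ regroup m (2 ^ e) ⟩
      suc m ℕ.* 2 ^ suc e           ≤⟨ ℕₚ.*-monoˡ-≤ (2 ^ suc e) m<2^j ⟩
      2 ^ j ℕ.* 2 ^ suc e           ≡⟨ ℕₚ.^-distribˡ-+-* 2 j (suc e) ⟨
      2 ^ (j ℕ.+ suc e)             ≡⟨ cong (2 ^_) (trans (ℕₚ.+-suc j e) (cong suc (ℕₚ.+-comm j e))) ⟩
      2 ^ n                         ∎
      where
      open ℕₚ.≤-Reasoning
      regroup : ∀ m h → m ℕ.* (2 ℕ.* h) ℕ.+ h ℕ.+ h ≡ suc m ℕ.* (2 ℕ.* h)
      regroup = solve-∀

    intIndHaar-/2^ : ∀ X → m ℕ.< 2 ^ j → intIndHaar j m (+ X /2^ n) ≡ - (dhat e m X /2^ n)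
    intIndHaar-/2^ X m<2^j = begin
      len∩ x 1ℚ (hl j m) (hm j m) - len∩ x 1ℚ (hm j m) (hr j m)
        ≡⟨ cong₂ _-_ (cong₂ (λ p q → len∩ x p q (hm j m)) (sym (2^*2^- n)) hl≡)
                     (cong₂ (λ p q → len∩ x p (hm j m) q) (sym (2^*2^- n)) hr≡) ⟩
      len∩ x (+ N /2^ n) (+ L /2^ n) (hm j m) - len∩ x (+ N /2^ n) (hm j m) (+ R /2^ n)
        ≡⟨ cong₂ _-_ (cong (len∩ x (+ N /2^ n) (+ L /2^ n)) hm≡) (cong (λ p → len∩ x (+ N /2^ n) p (+ R /2^ n)) hm≡) ⟩
      len∩ x (+ N /2^ n) (+ L /2^ n) (+ M /2^ n) - len∩ x (+ N /2^ n) (+ M /2^ n) (+ R /2^ n)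
        ≡⟨ cong₂ _-_ (len∩-/2^ n (+ X) (+ N) (+ L) (+ M)) (len∩-/2^ n (+ X) (+ N) (+ M) (+ R)) ⟩
      lenℤ (+ X) (+ N) (+ L) (+ M) /2^ n - lenℤ (+ X) (+ N) (+ M) (+ R) /2^ n
        ≡⟨ cong₂ (λ p q → p /2^ n - q /2^ n) (lenℤ-ℕ X N L M (ℕₚ.≤-trans (ℕₚ.m≤m+n M H) R≤N))
                                              (lenℤ-ℕ X N M R R≤N) ⟩
      + (M ℕ.∸ (X ℕ.⊔ L)) /2^ n - + (R ℕ.∸ (X ℕ.⊔ M)) /2^ n
        ≡⟨ /2^-- n (+ (M ℕ.∸ (X ℕ.⊔ L))) (+ (R ℕ.∸ (X ℕ.⊔ M))) ⟨
      (+ (M ℕ.∸ (X ℕ.⊔ L)) ℤ.- + (R ℕ.∸ (X ℕ.⊔ M))) /2^ n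
        ≡⟨ cong (λ z → z /2^ n) (trans (swap (+ (M ℕ.∸ (X ℕ.⊔ L))) (+ (R ℕ.∸ (X ℕ.⊔ M))))
                                       (cong ℤ.-_ (sym (hat≡overlaps L H X)))) ⟩
      (ℤ.- dhat e m X) /2^ n
        ≡⟨ /2^-neg n (dhat e m X) ⟩
      - (dhat e m X /2^ n) ∎
      where
      open ≡-Reasoning
      x : ℚ
      x = + X /2^ n
      N M R : ℕ
      N = 2 ^ n
      M = L ℕ.+ H
      R = L ℕ.+ H ℕ.+ H
      R≤N : R ℕ.≤ N
      R≤N = support≤ m<2^j
      swap : ∀ a b → a ℤ.- b ≡ ℤ.- (b ℤ.- a)
      swap = ℤ-Solver.solve-∀

  intIdHaar≡ : ∀ j m → intIdHaar j m ≡ - (2^- (suc j) * 2^- (suc j))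
  intIdHaar≡ j m = begin
    ½ * (hm j m * hm j m - l * l) - ½ * (hr j m * hr j m - hm j m * hm j m)
      ≡⟨ cong (λ r → ½ * (hm j m * hm j m - l * l) - ½ * (r * r - hm j m * hm j m)) hr≡l+h+h ⟩
    ½ * ((l + h) * (l + h) - l * l) - ½ * ((l + h + h) * (l + h + h) - (l + h) * (l + h))
      ≡⟨ second-difference ½ l h ⟩
    - ((½ + ½) * (h * h))
      ≡⟨ cong -_ (ℚₚ.*-identityˡ (h * h)) ⟩
    - (h * h) ∎
    where
    open ≡-Reasoning
    l h : ℚ
    l = hl j m
    h = 2^- (suc j)
    hr≡l+h+h : hr j m ≡ l + h + h
    hr≡l+h+h = begin
      ι (+ suc m) * 2^- j              ≡⟨ cong (_* 2^- j) (ι-+ (+ 1) (+ m)) ⟩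
      (1ℚ + ι (+ m)) * 2^- j           ≡⟨ spread ½ (ι (+ m)) (2^- j) ⟩
      ι (+ m) * 2^- j + ½ * 2^- j + ½ * 2^- j ∎
      where
      spread : ∀ w a b → ((w + w) + a) * b ≡ a * b + w * b + w * b
      spread = Solver.solve-∀ ℚ-ring
    second-difference : ∀ w l h → w * ((l + h) * (l + h) - l * l) - w * ((l + h + h) * (l + h + h) - (l + h) * (l + h)) ≡ - ((w + w) * (h * h))
    second-difference = Solver.solve-∀ ℚ-ring

  bit≡ι : ∀ b → bit b ≡ ι (+ bitℕ b)
  bit≡ι false = refl
  bit≡ι true  = refl

  xCoord≡ : ∀ n t → xCoord n t ≡ + xInt t /2^ n
  xCoord≡ zero    t = refl
  xCoord≡ (suc r) t = begin
    bit (head t) * 2^- (suc r) + xCoord r (tail t)     ≡⟨ cong₂ _+_ (cong (_* 2^- (suc r)) (bit≡ι (head t))) (xCoord≡ r (tail t)) ⟩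
    + bitℕ (head t) /2^ suc r + + X /2^ r              ≡⟨ cong (λ z → + bitℕ (head t) /2^ suc r + z) (/2^-*2^ (+ X) 1 r) ⟨
    + bitℕ (head t) /2^ suc r + (+ X ℤ.* + 2) /2^ suc r ≡⟨ /2^-+ (suc r) (+ bitℕ (head t)) (+ X ℤ.* + 2) ⟨
    (+ bitℕ (head t) ℤ.+ + X ℤ.* + 2) /2^ suc r         ≡⟨ cong (λ z → z /2^ suc r) (digits (bitℕ (head t)) X) ⟩
    + xInt t /2^ suc r                                  ∎
    where
    open ≡-Reasoning
    X : ℕ
    X = xInt (tail t)
    digits : ∀ b x → + b ℤ.+ + x ℤ.* + 2 ≡ + (b ℕ.+ 2 ℕ.* x)
    digits b x = trans (cong (λ z → + b ℤ.+ z) (trans (ℤₚ.*-comm (+ x) (+ 2)) (sym (ℤₚ.pos-* 2 x)))) (sym (ℤₚ.pos-+ b (2 ℕ.* x)))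

  -- yCoord runs a local loop whose exponent argument grows and which cannot be named; abstracting
  -- the initial exponent turns `yCoord n b ≡ loop 1 n b` into a pattern problem that solves for it.
  record YCoordLoop (loop : ℕ → (r : ℕ) → Vector Bool r → ℚ) : Set where
    field yCoord≡loop : ∀ n b → yCoord n b ≡ loop 1 n b

  yCoordLoop : YCoordLoop _
  YCoordLoop.yCoord≡loop yCoordLoop n b with 1
  ... | _ = refl

  private
    loopOf : ∀ {loop} → YCoordLoop loop → ℕ → (r : ℕ) → Vector Bool r → ℚ
    loopOf {loop} _ = loop

  yLoop : ℕ → (r : ℕ) → Vector Bool r → ℚ
  yLoop = loopOf yCoordLoop

  yLoop-bDigits : ∀ e K a σ t → yLoop (suc e) (suc K) (bDigits K a σ t) ≡ 2^- e * (+ yInt a σ t /2^ suc K)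
  yLoop-bDigits e zero a σ t = begin
    bit b * (½ * 2^- e) + 0ℚ              ≡⟨ cong (λ z → z * (½ * 2^- e) + 0ℚ) (bit≡ι b) ⟩
    ι (+ bitℕ b) * (½ * 2^- e) + 0ℚ       ≡⟨ regroup (ι (+ bitℕ b)) ½ (2^- e) ⟩
    2^- e * (ι (+ bitℕ b) * ½)            ≡⟨ cong (λ z → 2^- e * (ι (+ bitℕ b) * z)) (ℚₚ.*-identityʳ ½) ⟨
    2^- e * (ι (+ bitℕ b) * (½ * 1ℚ))     ∎
    where
    open ≡-Reasoning
    b : Bool
    b = head t xor head σ
    regroup : ∀ x w h → x * (w * h) + 0ℚ ≡ h * (x * w)
    regroup = Solver.solve-∀ ℚ-ring
  yLoop-bDigits e (suc K) a σ t = begin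
    bit b * (½ * 2^- e) + yLoop (suc (suc e)) (suc K) (bDigits K (tail a) (tail σ) (tail t))
      ≡⟨ cong₂ (λ x y → x * (½ * 2^- e) + y) (trans (cong bit (xor-assoc (head t) (head a ∧ last t) (head σ))) (bit≡ι b′))
                                              (yLoop-bDigits (suc e) K (tail a) (tail σ) (tail t)) ⟩
    ι (+ bitℕ b′) * (½ * 2^- e) + ½ * 2^- e * (ι (+ Y) * 2^- suc K)
      ≡⟨ regroup (ι (+ bitℕ b′)) (ι (+ Y)) ½ (2^- e) (2^- suc K) ⟩
    2^- e * (ι (+ bitℕ b′) * ½ + ι (+ Y) * (½ * 2^- suc K))
      ≡⟨ cong (λ z → 2^- e * (z + ι (+ Y) * (½ * 2^- suc K))) top ⟩
    2^- e * ((+ (bitℕ b′ ℕ.* 2 ^ suc K)) /2^ suc (suc K) + + Y /2^ suc (suc K))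
      ≡⟨ cong (2^- e *_) (/2^-+ (suc (suc K)) (+ (bitℕ b′ ℕ.* 2 ^ suc K)) (+ Y)) ⟨
    2^- e * ((+ (bitℕ b′ ℕ.* 2 ^ suc K) ℤ.+ + Y) /2^ suc (suc K))
      ≡⟨ cong (λ z → 2^- e * (z /2^ suc (suc K))) (ℤₚ.pos-+ (bitℕ b′ ℕ.* 2 ^ suc K) Y) ⟨
    2^- e * (+ yInt a σ t /2^ suc (suc K)) ∎
    where
    open ≡-Reasoning
    b b′ : Bool
    b  = (head t xor (head a ∧ last t)) xor head σ
    b′ = head t xor ((head a ∧ last t) xor head σ)
    Y : ℕ
    Y = yInt (tail a) (tail σ) (tail t)
    regroup : ∀ x y w h k → x * (w * h) + w * h * (y * k) ≡ h * (x * w + y * (w * k))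
    regroup = Solver.solve-∀ ℚ-ring
    top : ι (+ bitℕ b′) * ½ ≡ + (bitℕ b′ ℕ.* 2 ^ suc K) /2^ suc (suc K)
    top = sym (begin
      + (bitℕ b′ ℕ.* 2 ^ suc K) /2^ suc (suc K)        ≡⟨ cong₂ _/2^_ (ℤₚ.pos-* (bitℕ b′) (2 ^ suc K)) (ℕₚ.+-comm 1 (suc K)) ⟩
      (+ bitℕ b′ ℤ.* + 2 ^ suc K) /2^ (suc K ℕ.+ 1)    ≡⟨ /2^-*2^ (+ bitℕ b′) (suc K) 1 ⟩
      ι (+ bitℕ b′) * (½ * 1ℚ)                          ≡⟨ cong (ι (+ bitℕ b′) *_) (ℚₚ.*-identityʳ ½) ⟩
      ι (+ bitℕ b′) * ½                                 ∎)

  yCoord≡ : ∀ K a σ t → yCoord (suc K) (bDigits K a σ t) ≡ + yInt a σ t /2^ suc K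
  yCoord≡ K a σ t = trans (YCoordLoop.yCoord≡loop yCoordLoop (suc K) (bDigits K a σ t))
                          (trans (yLoop-bDigits 0 K a σ t) (ℚₚ.*-identityˡ _))

  inv-2* : ∀ k → inv (2 ℕ.* k) ≡ ½ * inv k
  inv-2* zero    = refl
  inv-2* (suc d) = cong (½ *_) (sym (ℚₚ.↥p/↧p≡p (mkℚ (+ 1) d (Coprime.1-coprimeTo (suc d)))))

  inv-2^ : ∀ n → inv (2 ^ n) ≡ 2^- n
  inv-2^ zero    = refl
  inv-2^ (suc n) = trans (inv-2* (2 ^ n)) (cong (½ *_) (inv-2^ n))

  sumList-++ : ∀ xs ys → sumList (xs List.++ ys) ≡ sumList xs + sumList ys
  sumList-++ List.[]         ys = sym (ℚₚ.+-identityˡ (sumList ys))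
  sumList-++ (x List.∷ xs) ys = trans (cong (λ s → x + s) (sumList-++ xs ys)) (sym (ℚₚ.+-assoc x (sumList xs) (sumList ys)))

  private
    Respects≗ : ∀ {k} → (Vector Bool k → ℤ) → Set
    Respects≗ F = ∀ {t u} → t ≗ u → F t ≡ F u

    split-sum : ∀ {k} (F : Vector Bool (suc k) → ℤ) q (c₀ c₁ : Vector Bool k → Vector Bool (suc k)) xs →
                (∀ t → c₀ t ≗ false ∷ t) → (∀ t → c₁ t ≗ true ∷ t) → Respects≗ F →
                (∀ G → Respects≗ G → sumList (List.map (λ t → ι (G t) * q) xs) ≡ ι (Σbits k G) * q) →
                sumList (List.map (λ t → ι (F t) * q) (List.map c₀ xs List.++ List.map c₁ xs)) ≡ ι (Σbits (suc k) F) * q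
    split-sum {k} F q c₀ c₁ xs c₀≗ c₁≗ F-cong sum-xs = begin
      sumList (List.map g (List.map c₀ xs List.++ List.map c₁ xs))
        ≡⟨ cong sumList (ListP.map-++ g (List.map c₀ xs) (List.map c₁ xs)) ⟩
      sumList (List.map g (List.map c₀ xs) List.++ List.map g (List.map c₁ xs))
        ≡⟨ sumList-++ (List.map g (List.map c₀ xs)) (List.map g (List.map c₁ xs)) ⟩
      sumList (List.map g (List.map c₀ xs)) + sumList (List.map g (List.map c₁ xs))
        ≡⟨ cong₂ (λ u v → sumList u + sumList v) (ListP.map-∘ xs) (ListP.map-∘ xs) ⟨
      sumList (List.map (λ t → g (c₀ t)) xs) + sumList (List.map (λ t → g (c₁ t)) xs)
        ≡⟨ cong₂ _+_ (sum-xs (λ t → F (c₀ t)) (λ t≗u → F-cong (λ i → cong-c₀ t≗u i)))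
                     (sum-xs (λ t → F (c₁ t)) (λ t≗u → F-cong (λ i → cong-c₁ t≗u i))) ⟩
      ι (Σbits k (λ t → F (c₀ t))) * q + ι (Σbits k (λ t → F (c₁ t))) * q
        ≡⟨ ℚₚ.*-distribʳ-+ q (ι (Σbits k (λ t → F (c₀ t)))) (ι (Σbits k (λ t → F (c₁ t)))) ⟨
      (ι (Σbits k (λ t → F (c₀ t))) + ι (Σbits k (λ t → F (c₁ t)))) * q
        ≡⟨ cong (_* q) (ι-+ (Σbits k (λ t → F (c₀ t))) (Σbits k (λ t → F (c₁ t)))) ⟨
      ι (Σbits k (λ t → F (c₀ t)) ℤ.+ Σbits k (λ t → F (c₁ t))) * q
        ≡⟨ cong (λ z → ι z * q) (Σbits-+ k (λ t → F (c₀ t)) (λ t → F (c₁ t))) ⟨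
      ι (Σbits k (λ t → F (c₀ t) ℤ.+ F (c₁ t))) * q
        ≡⟨ cong (λ z → ι z * q) (Σbits-cong k (λ t → cong₂ ℤ._+_ (F-cong (c₀≗ t)) (F-cong (c₁≗ t)))) ⟩
      ι (Σbits (suc k) F) * q ∎
      where
      open ≡-Reasoning
      g : Vector Bool (suc k) → ℚ
      g t = ι (F t) * q
      cong-c₀ : ∀ {t u} → t ≗ u → c₀ t ≗ c₀ u
      cong-c₀ {t} {u} t≗u i = trans (c₀≗ t i) (trans (cong-∷ t≗u i) (sym (c₀≗ u i)))
        where
        cong-∷ : ∀ {t u} → t ≗ u → (false ∷ t) ≗ (false ∷ u)
        cong-∷ t≗u zero    = refl
        cong-∷ t≗u (suc i) = t≗u i
      cong-c₁ : ∀ {t u} → t ≗ u → c₁ t ≗ c₁ u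
      cong-c₁ {t} {u} t≗u i = trans (c₁≗ t i) (trans (cong-∷ t≗u i) (sym (c₁≗ u i)))
        where
        cong-∷ : ∀ {t u} → t ≗ u → (true ∷ t) ≗ (true ∷ u)
        cong-∷ t≗u zero    = refl
        cong-∷ t≗u (suc i) = t≗u i

  sumList-allBits : ∀ k (F : Vector Bool k → ℤ) q → (∀ {t u} → t ≗ u → F t ≡ F u) →
                    sumList (List.map (λ t → ι (F t) * q) (allBits k)) ≡ ι (Σbits k F) * q
  sumList-allBits zero    F q F-cong = trans (ℚₚ.+-identityʳ (ι (F _) * q)) (cong (λ z → ι z * q) (F-cong (λ ())))
  sumList-allBits (suc k) F q F-cong =
    split-sum F q _ _ (allBits k) (λ t → λ { zero → refl ; (suc i) → refl }) (λ t → λ { zero → refl ; (suc i) → refl })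
              F-cong (λ G G-cong → sumList-allBits k G q G-cong)

  length-allBits : ∀ k → List.length (allBits k) ≡ 2 ^ k
  length-allBits zero    = refl
  length-allBits (suc k) = begin
    List.length (List.map _ (allBits k) List.++ List.map _ (allBits k))
      ≡⟨ ListP.length-++ (List.map _ (allBits k)) ⟩
    List.length (List.map _ (allBits k)) ℕ.+ List.length (List.map _ (allBits k))
      ≡⟨ cong₂ ℕ._+_ (trans (ListP.length-map _ (allBits k)) (length-allBits k))
                     (trans (ListP.length-map _ (allBits k)) (length-allBits k)) ⟩
    2 ^ k ℕ.+ 2 ^ k
      ≡⟨ cong (2 ^ k ℕ.+_) (ℕₚ.+-identityʳ (2 ^ k)) ⟨
    2 ^ suc k ∎
    where open ≡-Reasoning

module HaarCoefficient where

  open Bits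
  open Hat
  open DigitSums
  open Dyadic
  open import Data.Bool using (Bool; true; false)
  open import Data.Nat as ℕ using (ℕ; zero; suc; _^_; _<_; _≤_; _∸_)
  import Data.Nat.Properties as ℕₚ
  open import Data.Nat.Tactic.RingSolver using (solve-∀)
  open import Data.Integer as ℤ using (ℤ; +_)
  import Data.Integer.Properties as ℤₚ
  open import Data.Rational using (ℚ; 0ℚ; 1ℚ; _+_; _*_; _-_; -_; ∣_∣)
  import Data.Rational.Properties as ℚₚ
  open import Data.Vec.Functional using (Vector)
  import Data.List as List
  import Data.List.Properties as ListP
  open import Data.Product using (∃; _×_; _,_; proj₁; proj₂; map₂)
  open import Relation.Binary.PropositionalEquality
  import Tactic.RingSolver as Solver

  4^≡2^ : ∀ r → 4 ^ r ≡ 2 ^ (r ℕ.+ r)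
  4^≡2^ zero    = refl
  4^≡2^ (suc r) = trans (cong (4 ℕ.*_) (4^≡2^ r))
                        (trans (quadruple (2 ^ (r ℕ.+ r))) (cong (λ k → 2 ℕ.* 2 ^ k) (sym (ℕₚ.+-suc r r))))
    where
    quadruple : ∀ x → 4 ℕ.* x ≡ 2 ℕ.* (2 ℕ.* x)
    quadruple = solve-∀

  private

    2^-cancel : ∀ a b → ι (+ 2 ^ a) * 2^- (a ℕ.+ b) ≡ 2^- b
    2^-cancel a b = begin
      ι (+ 2 ^ a) * 2^- (a ℕ.+ b)          ≡⟨ cong (ι (+ 2 ^ a) *_) (2^-‿+ a b) ⟩
      ι (+ 2 ^ a) * (2^- a * 2^- b)        ≡⟨ ℚₚ.*-assoc (ι (+ 2 ^ a)) (2^- a) (2^- b) ⟨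
      ι (+ 2 ^ a) * 2^- a * 2^- b          ≡⟨ cong (_* 2^- b) (2^*2^- a) ⟩
      1ℚ * 2^- b                           ≡⟨ ℚₚ.*-identityˡ (2^- b) ⟩
      2^- b                                ∎
      where open ≡-Reasoning

    2^-cube : ∀ n x → 2^- n * (x * (2^- n * 2^- n)) ≡ x * 2^- (n ℕ.+ (n ℕ.+ n))
    2^-cube n x = trans (regroup (2^- n) x) (cong (x *_) (trans (cong (2^- n *_) (sym (2^-‿+ n n))) (sym (2^-‿+ n (n ℕ.+ n)))))
      where
      regroup : ∀ u x → u * (x * (u * u)) ≡ x * (u * (u * u))
      regroup = Solver.solve-∀ ℚ-ring

    0≤2^-*2^- : ∀ k → 0ℚ Data.Rational.≤ 2^- k * 2^- k
    0≤2^-*2^- k = ℚₚ.nonNegative⁻¹ (2^- k * 2^- k) {{ℚₚ.nonNeg*nonNeg⇒nonNeg (2^- k) {{2^-‿nonNeg k}} (2^- k) {{2^-‿nonNeg k}}}}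

    ∣±q∣≡q : ∀ {μ q} → 0ℚ Data.Rational.≤ q → (∃ λ s → μ ≡ ι (sgn s) * q) → ∣ μ ∣ ≡ q
    ∣±q∣≡q {q = q} 0≤q (s , μ≡±q) =
      trans (cong ∣_∣ μ≡±q) (trans (ℚₚ.∣p*q∣≡∣p∣*∣q∣ (ι (sgn s)) q)
                                  (trans (cong₂ _*_ (∣±1∣ s) (ℚₚ.0≤p⇒∣p∣≡p 0≤q)) (ℚₚ.*-identityˡ q)))
      where
      ∣±1∣ : ∀ s → ∣ ι (sgn s) ∣ ≡ 1ℚ
      ∣±1∣ false = refl
      ∣±1∣ true  = refl

  module _ (j₂ r j m₁ m₂ : ℕ) (a : Vector Bool (j₂ ℕ.+ suc r ℕ.+ suc j)) (σ : Vector Bool (suc (j₂ ℕ.+ suc r ℕ.+ suc j))) where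

    private
      K n A B : ℕ
      K = j₂ ℕ.+ suc r ℕ.+ suc j
      n = suc K
      A = 2 ^ n ℕ.* 4 ^ r
      B = 2 ^ (j₂ ℕ.+ (r ℕ.+ suc j))

      u h₁ h₂ c : ℚ
      u  = 2^- n
      h₁ = 2^- suc (suc j)
      h₂ = 2^- suc j₂
      c  = 2^- suc n * 2^- suc n

      F : Vector Bool n → ℤ
      F t = dhat (j₂ ℕ.+ suc r) m₁ (xInt t) ℤ.* dhat (suc r ℕ.+ suc j) m₂ (yInt a σ t)

      u³A≡h₁²h₂² : u * (ι (+ A) * (u * u)) ≡ h₁ * h₁ * (h₂ * h₂)
      u³A≡h₁²h₂² = begin
        u * (ι (+ A) * (u * u))                          ≡⟨ 2^-cube n (ι (+ A)) ⟩
        ι (+ A) * 2^- (n ℕ.+ (n ℕ.+ n))                  ≡⟨ cong₂ (λ p q → ι (+ p) * 2^- q) A≡ exponent ⟩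
        ι (+ 2 ^ (n ℕ.+ (r ℕ.+ r))) * 2^- (n ℕ.+ (r ℕ.+ r) ℕ.+ (e₁ ℕ.+ e₁ ℕ.+ (e₂ ℕ.+ e₂)))
                                                         ≡⟨ 2^-cancel (n ℕ.+ (r ℕ.+ r)) (e₁ ℕ.+ e₁ ℕ.+ (e₂ ℕ.+ e₂)) ⟩
        2^- (e₁ ℕ.+ e₁ ℕ.+ (e₂ ℕ.+ e₂))                  ≡⟨ 2^-‿+ (e₁ ℕ.+ e₁) (e₂ ℕ.+ e₂) ⟩
        2^- (e₁ ℕ.+ e₁) * 2^- (e₂ ℕ.+ e₂)                ≡⟨ cong₂ _*_ (2^-‿+ e₁ e₁) (2^-‿+ e₂ e₂) ⟩
        h₁ * h₁ * (h₂ * h₂)                              ∎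
        where
        open ≡-Reasoning
        e₁ e₂ : ℕ
        e₁ = suc (suc j)
        e₂ = suc j₂
        A≡ : A ≡ 2 ^ (n ℕ.+ (r ℕ.+ r))
        A≡ = trans (cong (2 ^ n ℕ.*_) (4^≡2^ r)) (sym (ℕₚ.^-distribˡ-+-* 2 n (r ℕ.+ r)))
        exponent : n ℕ.+ (n ℕ.+ n) ≡ n ℕ.+ (r ℕ.+ r) ℕ.+ (suc (suc j) ℕ.+ suc (suc j) ℕ.+ (suc j₂ ℕ.+ suc j₂))
        exponent = arith j₂ r j
          where
          arith : ∀ j₂ r j → let n = suc (j₂ ℕ.+ suc r ℕ.+ suc j) in
                  n ℕ.+ (n ℕ.+ n) ≡ n ℕ.+ (r ℕ.+ r) ℕ.+ (suc (suc j) ℕ.+ suc (suc j) ℕ.+ (suc j₂ ℕ.+ suc j₂))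
          arith = solve-∀

      u³B≡c : u * (ι (+ B) * (u * u)) ≡ c
      u³B≡c = begin
        u * (ι (+ B) * (u * u))                                     ≡⟨ 2^-cube n (ι (+ B)) ⟩
        ι (+ B) * 2^- (n ℕ.+ (n ℕ.+ n))                             ≡⟨ cong (λ q → ι (+ B) * 2^- q) exponent ⟩
        ι (+ B) * 2^- (j₂ ℕ.+ (r ℕ.+ suc j) ℕ.+ (suc n ℕ.+ suc n))  ≡⟨ 2^-cancel (j₂ ℕ.+ (r ℕ.+ suc j)) (suc n ℕ.+ suc n) ⟩
        2^- (suc n ℕ.+ suc n)                                       ≡⟨ 2^-‿+ (suc n) (suc n) ⟩
        c                                                           ∎
        where
        open ≡-Reasoning
        exponent : n ℕ.+ (n ℕ.+ n) ≡ j₂ ℕ.+ (r ℕ.+ suc j) ℕ.+ (suc n ℕ.+ suc n)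
        exponent = arith j₂ r j
          where
          arith : ∀ j₂ r j → let n = suc (j₂ ℕ.+ suc r ℕ.+ suc j) in
                  n ℕ.+ (n ℕ.+ n) ≡ j₂ ℕ.+ (r ℕ.+ suc j) ℕ.+ (suc n ℕ.+ suc n)
          arith = solve-∀

      F-cong : ∀ {t t′} → t ≗ t′ → F t ≡ F t′
      F-cong t≗t′ = cong₂ (λ x y → dhat (j₂ ℕ.+ suc r) m₁ x ℤ.* dhat (suc r ℕ.+ suc j) m₂ y)
                          (xInt-cong t≗t′) (yInt-cong a σ t≗t′)

      y-level : n ≡ suc (suc r ℕ.+ suc j ℕ.+ j₂)
      y-level = arith j₂ r j
        where
        arith : ∀ j₂ r j → suc (j₂ ℕ.+ suc r ℕ.+ suc j) ≡ suc (suc r ℕ.+ suc j ℕ.+ j₂)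
        arith = solve-∀

      point-term : m₁ < 2 ^ suc j → m₂ < 2 ^ j₂ → ∀ t →
                   intIndHaar (suc j) m₁ (xCoord n t) * intIndHaar j₂ m₂ (yCoord n (bDigits K a σ t)) ≡ ι (F t) * (u * u)
      point-term m₁<2^j₁ m₂<2^j₂ t = begin
        intIndHaar (suc j) m₁ (xCoord n t) * intIndHaar j₂ m₂ (yCoord n (bDigits K a σ t))
          ≡⟨ cong₂ (λ x y → intIndHaar (suc j) m₁ x * intIndHaar j₂ m₂ y) (xCoord≡ n t) (yCoord≡ K a σ t) ⟩
        intIndHaar (suc j) m₁ (+ xInt t /2^ n) * intIndHaar j₂ m₂ (+ yInt a σ t /2^ n)
          ≡⟨ cong₂ _*_ (intIndHaar-/2^ (j₂ ℕ.+ suc r) (suc j) m₁ (xInt t) m₁<2^j₁) y-term ⟩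
        (- (τˣ /2^ n)) * (- (τʸ /2^ n))
          ≡⟨ negate² (ι τˣ) (ι τʸ) u ⟩
        ι τˣ * ι τʸ * (u * u)
          ≡⟨ cong (_* (u * u)) (ι-* τˣ τʸ) ⟨
        ι (F t) * (u * u) ∎
        where
        open ≡-Reasoning
        τˣ τʸ : ℤ
        τˣ = dhat (j₂ ℕ.+ suc r) m₁ (xInt t)
        τʸ = dhat (suc r ℕ.+ suc j) m₂ (yInt a σ t)
        negate² : ∀ x y u → (- (x * u)) * (- (y * u)) ≡ x * y * (u * u)
        negate² = Solver.solve-∀ ℚ-ring
        y-term : intIndHaar j₂ m₂ (+ yInt a σ t /2^ n) ≡ - (τʸ /2^ n)
        y-term = trans (cong (λ k → intIndHaar j₂ m₂ (+ yInt a σ t /2^ k)) y-level)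
                       (trans (intIndHaar-/2^ (suc r ℕ.+ suc j) j₂ m₂ (yInt a σ t) m₂<2^j₂)
                              (cong (λ k → - (τʸ /2^ k)) (sym y-level)))

    haarCoeff≡± : m₁ < 2 ^ suc j → m₂ < 2 ^ j₂ →
                  ∃ λ s → haarCoeff (pointSet (suc (j₂ ℕ.+ suc r ℕ.+ suc j)) a σ) (suc j) j₂ m₁ m₂ ≡ ι (sgn s) * c
    haarCoeff≡± m₁<2^j₁ m₂<2^j₂ = map₂ (λ {s} → from-Σ s) (Σbits-hat*hat j₂ r j m₁ m₂ a σ m₁<2^j₁ m₂<2^j₂)
      where
      open ≡-Reasoning
      ψ : Vector Bool n → ℚ × ℚ
      ψ t = xCoord n t , yCoord n (bDigits K a σ t)
      φ : ℚ × ℚ → ℚ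
      φ z = intIndHaar (suc j) m₁ (proj₁ z) * intIndHaar j₂ m₂ (proj₂ z)
      from-Σ : ∀ s → Σbits n F ≡ + A ℤ.+ sgn s ℤ.* + B → haarCoeff (pointSet n a σ) (suc j) j₂ m₁ m₂ ≡ ι (sgn s) * c
      from-Σ s ΣF≡ = begin
        inv (List.length (List.map ψ (allBits n))) * sumList (List.map φ (List.map ψ (allBits n)))
          - intIdHaar (suc j) m₁ * intIdHaar j₂ m₂
            ≡⟨ cong₂ _-_ (cong₂ _*_ weight sum) (cong₂ _*_ (intIdHaar≡ (suc j) m₁) (intIdHaar≡ j₂ m₂)) ⟩
        u * (ι (Σbits n F) * (u * u)) - (- (h₁ * h₁)) * (- (h₂ * h₂))
            ≡⟨ cong (λ z → u * (z * (u * u)) - (- (h₁ * h₁)) * (- (h₂ * h₂)))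
                    (trans (cong ι ΣF≡) (trans (ι-+ (+ A) (sgn s ℤ.* + B)) (cong (λ z → ι (+ A) + z) (ι-* (sgn s) (+ B))))) ⟩
        u * ((ι (+ A) + ι (sgn s) * ι (+ B)) * (u * u)) - (- (h₁ * h₁)) * (- (h₂ * h₂))
            ≡⟨ expand u (ι (+ A)) (ι (sgn s)) (ι (+ B)) (h₁ * h₁) (h₂ * h₂) ⟩
        (u * (ι (+ A) * (u * u)) - h₁ * h₁ * (h₂ * h₂)) + ι (sgn s) * (u * (ι (+ B) * (u * u)))
            ≡⟨ cong₂ (λ p q → (p - h₁ * h₁ * (h₂ * h₂)) + ι (sgn s) * q) u³A≡h₁²h₂² u³B≡c ⟩
        (h₁ * h₁ * (h₂ * h₂) - h₁ * h₁ * (h₂ * h₂)) + ι (sgn s) * c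
            ≡⟨ cong (_+ ι (sgn s) * c) (ℚₚ.+-inverseʳ (h₁ * h₁ * (h₂ * h₂))) ⟩
        0ℚ + ι (sgn s) * c
            ≡⟨ ℚₚ.+-identityˡ (ι (sgn s) * c) ⟩
        ι (sgn s) * c ∎
        where
        expand : ∀ u a s b x y → u * ((a + s * b) * (u * u)) - (- x) * (- y) ≡ (u * (a * (u * u)) - x * y) + s * (u * (b * (u * u)))
        expand = Solver.solve-∀ ℚ-ring
        weight : inv (List.length (List.map ψ (allBits n))) ≡ u
        weight = trans (cong inv (trans (ListP.length-map ψ (allBits n)) (length-allBits n))) (inv-2^ n)
        sum : sumList (List.map φ (List.map ψ (allBits n))) ≡ ι (Σbits n F) * (u * u)
        sum = begin
          sumList (List.map φ (List.map ψ (allBits n)))             ≡⟨ cong sumList (ListP.map-∘ (allBits n)) ⟨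
          sumList (List.map (λ t → φ (ψ t)) (allBits n))            ≡⟨ cong sumList (ListP.map-cong (point-term m₁<2^j₁ m₂<2^j₂)
                                                                                                        (allBits n)) ⟩
          sumList (List.map (λ t → ι (F t) * (u * u)) (allBits n))  ≡⟨ sumList-allBits n F (u * u) F-cong ⟩
          ι (Σbits n F) * (u * u)                                   ∎

  ∣haarCoeff∣≡ : ∀ n j₁ j₂ m₁ m₂ (a : Vector Bool (n ∸ 1)) σ →
                 1 ≤ j₁ → j₁ ℕ.+ j₂ ≤ n ∸ 2 → m₁ < 2 ^ j₁ → m₂ < 2 ^ j₂ →
                 ∣ haarCoeff (pointSet n a σ) j₁ j₂ m₁ m₂ ∣ ≡ 2^- suc n * 2^- suc n
  ∣haarCoeff∣≡ n              zero    j₂ m₁ m₂ a σ () _ _ _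
  ∣haarCoeff∣≡ zero           (suc j) j₂ m₁ m₂ a σ _ () _ _
  ∣haarCoeff∣≡ (suc zero)     (suc j) j₂ m₁ m₂ a σ _ () _ _
  ∣haarCoeff∣≡ (suc (suc N)) (suc j) j₂ m₁ m₂ a σ _ j₁+j₂≤N m₁<2^j₁ m₂<2^j₂ = at-level (suc (suc N)) n≡ a σ
    where
    r : ℕ
    r = N ∸ (suc j ℕ.+ j₂)
    n≡ : suc (suc N) ≡ suc (j₂ ℕ.+ suc r ℕ.+ suc j)
    n≡ = cong suc (trans (cong suc (sym (ℕₚ.m+[n∸m]≡n j₁+j₂≤N))) (regroup j j₂ r))
      where
      regroup : ∀ j j₂ r → suc (suc j ℕ.+ j₂ ℕ.+ r) ≡ j₂ ℕ.+ suc r ℕ.+ suc j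
      regroup = solve-∀
    at-level : ∀ n → n ≡ suc (j₂ ℕ.+ suc r ℕ.+ suc j) → ∀ (a : Vector Bool (n ∸ 1)) σ →
               ∣ haarCoeff (pointSet n a σ) (suc j) j₂ m₁ m₂ ∣ ≡ 2^- suc n * 2^- suc n
    at-level _ refl a σ =
      ∣±q∣≡q (0≤2^-*2^- (suc (suc (j₂ ℕ.+ suc r ℕ.+ suc j)))) (haarCoeff≡± j₂ r j m₁ m₂ a σ m₁<2^j₁ m₂<2^j₂)

module Counting where

  open import Data.Bool using (if_then_else_)
  open import Data.Bool.Properties using (∧-zeroʳ; ∧-identityʳ)
  open import Data.Nat
  open import Data.Nat.Properties
  open import Data.Nat.Tactic.RingSolver using (solve-∀)
  open import Function.Bundles using (mk⇔)
  open import Relation.Binary.PropositionalEquality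
  open import Relation.Nullary using (yes; no)
  open import Relation.Nullary.Decidable using (⌊_⌋; does-⇔; isYes≗does)

  Σℕ : ℕ → (ℕ → ℕ) → ℕ
  Σℕ zero    f = 0
  Σℕ (suc k) f = Σℕ k f + f k

  Σℕ-cong : ∀ k {f g} → (∀ i → i < k → f i ≡ g i) → Σℕ k f ≡ Σℕ k g
  Σℕ-cong zero    f≗g = refl
  Σℕ-cong (suc k) f≗g = cong₂ _+_ (Σℕ-cong k (λ i i<k → f≗g i (m<n⇒m<1+n i<k))) (f≗g k ≤-refl)

  Σℕ-head : ∀ k f → Σℕ (suc k) f ≡ f 0 + Σℕ k (λ i → f (suc i))
  Σℕ-head zero    f = sym (+-identityʳ (f 0))
  Σℕ-head (suc k) f = trans (cong (_+ f (suc k)) (Σℕ-head k f)) (+-assoc (f 0) _ _)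

  Σℕ-+ : ∀ k f g → Σℕ k (λ i → f i + g i) ≡ Σℕ k f + Σℕ k g
  Σℕ-+ zero    f g = refl
  Σℕ-+ (suc k) f g = trans (cong (_+ (f k + g k)) (Σℕ-+ k f g)) (interchange (Σℕ k f) (Σℕ k g) (f k) (g k))
    where
    interchange : ∀ a b c d → a + b + (c + d) ≡ a + c + (b + d)
    interchange = solve-∀

  Σℕ-*ˡ : ∀ k c f → Σℕ k (λ i → c * f i) ≡ c * Σℕ k f
  Σℕ-*ˡ zero    c f = sym (*-zeroʳ c)
  Σℕ-*ˡ (suc k) c f = trans (cong (_+ c * f k) (Σℕ-*ˡ k c f)) (sym (*-distribˡ-+ c (Σℕ k f) (f k)))

  Σℕ-const : ∀ k c → Σℕ k (λ _ → c) ≡ k * c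
  Σℕ-const zero    c = refl
  Σℕ-const (suc k) c = trans (cong (_+ c) (Σℕ-const k c)) (+-comm (k * c) c)

  Σℕ-filter : ∀ M N g → Σℕ M (λ j → if ⌊ j <? N ⌋ then g j else 0) ≡ Σℕ (M ⊓ N) g
  Σℕ-filter zero    N g = refl
  Σℕ-filter (suc M) N g with M <? N
  ... | yes M<N = trans (cong (_+ g M) (Σℕ-filter M N g))
                        (trans (cong (λ k → Σℕ k g + g M) (m≤n⇒m⊓n≡m (<⇒≤ M<N)))
                               (cong (λ k → Σℕ k g) (sym (m≤n⇒m⊓n≡m M<N))))
  ... | no  M≮N = trans (+-identityʳ _) (trans (Σℕ-filter M N g)
                        (cong (λ k → Σℕ k g) (trans (m≥n⇒m⊓n≡n N≤M) (sym (m≥n⇒m⊓n≡n (m≤n⇒m≤1+n N≤M))))))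
    where
    N≤M : N ≤ M
    N≤M = ≮⇒≥ M≮N

  geometric : ∀ a L → 3 * Σℕ L (λ j → 4 ^ (a + j)) + 4 ^ a ≡ 4 ^ (a + L)
  geometric a zero    = cong (4 ^_) (sym (+-identityʳ a))
  geometric a (suc L) = begin
    3 * (Σℕ L (λ j → 4 ^ (a + j)) + 4 ^ (a + L)) + 4 ^ a   ≡⟨ regroup (Σℕ L (λ j → 4 ^ (a + j))) (4 ^ (a + L)) (4 ^ a) ⟩
    (3 * Σℕ L (λ j → 4 ^ (a + j)) + 4 ^ a) + 3 * 4 ^ (a + L) ≡⟨ cong (_+ 3 * 4 ^ (a + L)) (geometric a L) ⟩
    4 ^ (a + L) + 3 * 4 ^ (a + L)                          ≡⟨ quadruple (4 ^ (a + L)) ⟩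
    4 ^ suc (a + L)                                        ≡⟨ cong (4 ^_) (+-suc a L) ⟨
    4 ^ (a + suc L)                                        ∎
    where
    open ≡-Reasoning
    regroup : ∀ s p q → 3 * (s + p) + q ≡ (3 * s + q) + 3 * p
    regroup = solve-∀
    quadruple : ∀ p → p + 3 * p ≡ 4 * p
    quadruple = solve-∀

  J9-weight : ℕ → ℕ → ℕ → ℕ
  J9-weight n j₁ j₂ = if inJ9 n j₁ j₂ then 4 ^ (j₁ + j₂) else 0

  J9-total : ℕ → ℕ
  J9-total n = Σℕ (suc n) λ j₁ → Σℕ (suc n) λ j₂ → J9-weight n j₁ j₂

  private
    row : ℕ → ℕ → ℕ
    row N i = Σℕ (N ∸ i) (λ j → 4 ^ (suc i + j))

    row-zero : ∀ n → Σℕ (suc n) (J9-weight n 0) ≡ 0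
    row-zero n = trans (Σℕ-cong (suc n) (λ j _ → cong (λ b → if b then 4 ^ j else 0) (∧-zeroʳ _)))
                       (trans (Σℕ-const (suc n) 0) (*-zeroʳ (suc n)))

    row-suc : ∀ N i → Σℕ (3 + N) (J9-weight (2 + N) (suc i)) ≡ row N i
    row-suc N i = trans (Σℕ-cong (3 + N) (λ j _ → cong (λ b → if b then 4 ^ (suc i + j) else 0) (trans (∧-identityʳ _) (in-row j))))
                        (trans (Σℕ-filter (3 + N) (N ∸ i) (λ j → 4 ^ (suc i + j)))
                               (cong (λ k → Σℕ k (λ j → 4 ^ (suc i + j))) (m≥n⇒m⊓n≡n N∸i≤3+N)))
      where
      N∸i≤3+N : N ∸ i ≤ 3 + N
      N∸i≤3+N = ≤-trans (m∸n≤m N i) (m≤n+m N 3)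
      in-row : ∀ j → ⌊ suc i + j ≤? N ⌋ ≡ ⌊ j <? N ∸ i ⌋
      in-row j = trans (isYes≗does (suc i + j ≤? N))
                       (trans (does-⇔ (mk⇔ to from) (suc i + j ≤? N) (j <? N ∸ i)) (sym (isYes≗does (j <? N ∸ i))))
        where
        to : suc i + j ≤ N → j < N ∸ i
        to i+j<N = m+n≤o⇒m≤o∸n (suc j) (subst (_≤ N) (cong suc (+-comm i j)) i+j<N)
        from : j < N ∸ i → suc i + j ≤ N
        from j<N∸i = subst (_≤ N) (cong suc (+-comm j i))
                           (m≤o∸n⇒m+n≤o (suc j) (<⇒≤ (m∸n≢0⇒n<m (m<n⇒n≢0 j<N∸i))) j<N∸i)

    row-beyond : ∀ N i → N ≤ i → row N i ≡ 0
    row-beyond N i N≤i = cong (λ k → Σℕ k (λ j → 4 ^ (suc i + j))) (m≤n⇒m∸n≡0 N≤i)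

    row-geometric : ∀ N i → i ≤ N → 3 * row N i + 4 ^ suc i ≡ 4 ^ suc N
    row-geometric N i i≤N = trans (geometric (suc i) (N ∸ i)) (cong (λ k → 4 ^ suc k) (m+[n∸m]≡n i≤N))

  J9-total-closed : ∀ N → 36 * J9-total (2 + N) + 7 * 4 ^ (2 + N) ≡ 3 * (2 + N) * 4 ^ (2 + N) + 16
  J9-total-closed N = begin
    36 * Q + 7 * (4 * P)             ≡⟨ regroup Q P ⟩
    4 * (9 * Q + P) + 24 * P         ≡⟨ cong (λ z → 4 * z + 24 * P) nine-Q ⟩
    4 * (3 * (N * P) + 4) + 24 * P   ≡⟨ collect N P ⟩
    3 * (2 + N) * (4 * P) + 16       ∎
    where
    open ≡-Reasoning
    P Q R S : ℕ
    P = 4 ^ suc N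
    Q = J9-total (2 + N)
    R = Σℕ N (row N)
    S = Σℕ N (λ i → 4 ^ (1 + i))
    regroup : ∀ q p → 36 * q + 7 * (4 * p) ≡ 4 * (9 * q + p) + 24 * p
    regroup = solve-∀
    collect : ∀ n p → 4 * (3 * (n * p) + 4) + 24 * p ≡ 3 * (2 + n) * (4 * p) + 16
    collect = solve-∀
    Q≡R : Q ≡ R
    Q≡R = begin
      Q                                                        ≡⟨ Σℕ-head (2 + N) _ ⟩
      Σℕ (3 + N) (J9-weight (2 + N) 0) + Σℕ (2 + N) (λ i → Σℕ (3 + N) (J9-weight (2 + N) (suc i)))
                                                               ≡⟨ cong₂ _+_ (row-zero (2 + N)) (Σℕ-cong (2 + N) (λ i _ → row-suc N i)) ⟩
      Σℕ (2 + N) (row N)                                       ≡⟨ cong₂ (λ p q → R + p + q) (row-beyond N N ≤-refl)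
                                                                                            (row-beyond N (suc N) (n≤1+n N)) ⟩
      R + 0 + 0                                                ≡⟨ trans (+-identityʳ (R + 0)) (+-identityʳ R) ⟩
      R                                                        ∎
    3R+S≡NP : 3 * R + S ≡ N * P
    3R+S≡NP = begin
      3 * R + S                                   ≡⟨ cong (_+ S) (Σℕ-*ˡ N 3 (row N)) ⟨
      Σℕ N (λ i → 3 * row N i) + S                ≡⟨ Σℕ-+ N (λ i → 3 * row N i) (λ i → 4 ^ (1 + i)) ⟨
      Σℕ N (λ i → 3 * row N i + 4 ^ (1 + i))      ≡⟨ Σℕ-cong N (λ i i<N → row-geometric N i (<⇒≤ i<N)) ⟩
      Σℕ N (λ _ → P)                              ≡⟨ Σℕ-const N P ⟩
      N * P                                       ∎
    nine-Q : 9 * Q + P ≡ 3 * (N * P) + 4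
    nine-Q = begin
      9 * Q + P                 ≡⟨ cong (λ z → 9 * z + P) Q≡R ⟩
      9 * R + P                 ≡⟨ cong (9 * R +_) (geometric 1 N) ⟨
      9 * R + (3 * S + 4)       ≡⟨ regroup′ R S ⟩
      3 * (3 * R + S) + 4       ≡⟨ cong (λ z → 3 * z + 4) 3R+S≡NP ⟩
      3 * (N * P) + 4           ∎
      where
      regroup′ : ∀ r s → 9 * r + (3 * s + 4) ≡ 3 * (3 * r + s) + 4
      regroup′ = solve-∀

module RationalSums where

  open Dyadic using (ι; ι-+; ι-*)
  open Counting using (Σℕ)
  open import Data.Nat as ℕ using (ℕ; zero; suc; _<_)
  import Data.Nat.Properties as ℕₚ
  import Data.Integer.Properties as ℤₚ
  open import Data.Integer using (+_)
  open import Data.Rational using (ℚ; 0ℚ; 1ℚ; _+_; _*_)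
  import Data.Rational.Properties as ℚₚ
  open import Relation.Binary.PropositionalEquality

  ℕ→ℚ-+ : ∀ a b → ℕ→ℚ (a ℕ.+ b) ≡ ℕ→ℚ a + ℕ→ℚ b
  ℕ→ℚ-+ a b = trans (cong ι (ℤₚ.pos-+ a b)) (ι-+ (+ a) (+ b))

  ℕ→ℚ-* : ∀ a b → ℕ→ℚ (a ℕ.* b) ≡ ℕ→ℚ a * ℕ→ℚ b
  ℕ→ℚ-* a b = trans (cong ι (ℤₚ.pos-* a b)) (ι-* (+ a) (+ b))

  ℕ→ℚ-^ : ∀ a k → ℕ→ℚ a ^ℚ k ≡ ℕ→ℚ (a ℕ.^ k)
  ℕ→ℚ-^ a zero    = refl
  ℕ→ℚ-^ a (suc k) = trans (cong (ℕ→ℚ a *_) (ℕ→ℚ-^ a k)) (sym (ℕ→ℚ-* a (a ℕ.^ k)))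

  Σ<-cong : ∀ k {f g : ℕ → ℚ} → (∀ i → i < k → f i ≡ g i) → Σ< k f ≡ Σ< k g
  Σ<-cong zero    f≗g = refl
  Σ<-cong (suc k) f≗g = cong₂ _+_ (Σ<-cong k (λ i i<k → f≗g i (ℕₚ.m<n⇒m<1+n i<k))) (f≗g k ℕₚ.≤-refl)

  Σ<-ℕ : ∀ k (f : ℕ → ℕ) q → Σ< k (λ i → ℕ→ℚ (f i) * q) ≡ ℕ→ℚ (Σℕ k f) * q
  Σ<-ℕ zero    f q = sym (ℚₚ.*-zeroˡ q)
  Σ<-ℕ (suc k) f q = trans (cong (_+ ℕ→ℚ (f k) * q) (Σ<-ℕ k f q))
                           (trans (sym (ℚₚ.*-distribʳ-+ q (ℕ→ℚ (Σℕ k f)) (ℕ→ℚ (f k))))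
                                  (cong (_* q) (sym (ℕ→ℚ-+ (Σℕ k f) (f k)))))

  Σ<-const : ∀ k q → Σ< k (λ _ → q) ≡ ℕ→ℚ k * q
  Σ<-const k q = trans (Σ<-cong k (λ _ _ → sym (ℚₚ.*-identityˡ q))) (trans (Σ<-ℕ k (λ _ → 1) q)
                       (cong (λ m → ℕ→ℚ m * q) (trans (Counting.Σℕ-const k 1) (ℕₚ.*-identityʳ k))))


open HaarCoefficient using (4^≡2^; ∣haarCoeff∣≡)
open Counting using (Σℕ; J9-weight; J9-total; J9-total-closed)
open RationalSums
open import Data.Bool using (Bool; true; false; _∧_; if_then_else_)
open import Data.Nat as ℕ using (ℕ; zero; suc; _≤_; _∸_; _≤?_; s≤s)
import Data.Nat.Properties as ℕₚ
open import Data.Nat.Tactic.RingSolver using (solve-∀)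
open import Data.Integer using (+_)
open import Data.Rational using (ℚ; 0ℚ; 1ℚ; _+_; _*_; _-_; _/_; ∣_∣)
import Data.Rational.Properties as ℚₚ
open import Data.Fin using (Fin)
open import Data.Product using (_×_; _,_)
open import Relation.Binary.PropositionalEquality
open import Relation.Nullary using (Dec; yes; no)
open import Relation.Nullary.Decidable using (⌊_⌋)
import Tactic.RingSolver as Solver

μ² : ℕ → ℚ
μ² n = (2^- suc n * 2^- suc n) ^ℚ 2

inJ9⇒ : ∀ n j₁ j₂ → inJ9 n j₁ j₂ ≡ true → 1 ≤ j₁ × j₁ ℕ.+ j₂ ≤ n ∸ 2
inJ9⇒ n j₁ j₂ = both (j₁ ℕ.+ j₂ ≤? n ∸ 2) (1 ≤? j₁)
  where
  both : ∀ {P Q : Set} (p? : Dec P) (q? : Dec Q) → (⌊ p? ⌋ ∧ ⌊ q? ⌋) ≡ true → Q × P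
  both (yes p) (yes q) _ = q , p
  both (yes _) (no _)  ()
  both (no _)  _       ()

J9-term : ∀ n (a : Fin (n ∸ 1) → Bool) σ j₁ j₂ →
          (if inJ9 n j₁ j₂
           then ℕ→ℚ (2 ℕ.^ (j₁ ℕ.+ j₂)) *
                (Σ< (2 ℕ.^ j₁) λ m₁ → Σ< (2 ℕ.^ j₂) λ m₂ → ∣ haarCoeff (pointSet n a σ) j₁ j₂ m₁ m₂ ∣ ^ℚ 2)
           else 0ℚ)
          ≡ ℕ→ℚ (J9-weight n j₁ j₂) * μ² n
J9-term n a σ j₁ j₂ with inJ9 n j₁ j₂ in J9?
... | false = sym (ℚₚ.*-zeroˡ (μ² n))
... | true with inJ9⇒ n j₁ j₂ J9?
...   | 1≤j₁ , j₁+j₂≤n-2 = begin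
  ℕ→ℚ (2 ℕ.^ s) * (Σ< (2 ℕ.^ j₁) λ m₁ → Σ< (2 ℕ.^ j₂) λ m₂ → ∣ haarCoeff (pointSet n a σ) j₁ j₂ m₁ m₂ ∣ ^ℚ 2)
    ≡⟨ cong (ℕ→ℚ (2 ℕ.^ s) *_) (Σ<-cong (2 ℕ.^ j₁) (λ m₁ m₁<2^j₁ → Σ<-cong (2 ℕ.^ j₂) (λ m₂ m₂<2^j₂ →
         cong (_^ℚ 2) (∣haarCoeff∣≡ n j₁ j₂ m₁ m₂ a σ 1≤j₁ j₁+j₂≤n-2 m₁<2^j₁ m₂<2^j₂)))) ⟩
  ℕ→ℚ (2 ℕ.^ s) * (Σ< (2 ℕ.^ j₁) λ _ → Σ< (2 ℕ.^ j₂) λ _ → μ² n)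
    ≡⟨ cong (ℕ→ℚ (2 ℕ.^ s) *_) (trans (Σ<-const (2 ℕ.^ j₁) (Σ< (2 ℕ.^ j₂) λ _ → μ² n))
                                     (cong (ℕ→ℚ (2 ℕ.^ j₁) *_) (Σ<-const (2 ℕ.^ j₂) (μ² n)))) ⟩
  ℕ→ℚ (2 ℕ.^ s) * (ℕ→ℚ (2 ℕ.^ j₁) * (ℕ→ℚ (2 ℕ.^ j₂) * μ² n))
    ≡⟨ regroup (ℕ→ℚ (2 ℕ.^ s)) (ℕ→ℚ (2 ℕ.^ j₁)) (ℕ→ℚ (2 ℕ.^ j₂)) (μ² n) ⟩
  ℕ→ℚ (2 ℕ.^ s) * (ℕ→ℚ (2 ℕ.^ j₁) * ℕ→ℚ (2 ℕ.^ j₂)) * μ² n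
    ≡⟨ cong (_* μ² n) (trans (cong (ℕ→ℚ (2 ℕ.^ s) *_) (sym (ℕ→ℚ-* (2 ℕ.^ j₁) (2 ℕ.^ j₂))))
                             (trans (sym (ℕ→ℚ-* (2 ℕ.^ s) _)) (cong ℕ→ℚ 2^s*2^s≡4^s))) ⟩
  ℕ→ℚ (4 ℕ.^ s) * μ² n ∎
  where
  open ≡-Reasoning
  s : ℕ
  s = j₁ ℕ.+ j₂
  regroup : ∀ a b c q → a * (b * (c * q)) ≡ a * (b * c) * q
  regroup = Solver.solve-∀ Dyadic.ℚ-ring
  2^s*2^s≡4^s : 2 ℕ.^ s ℕ.* (2 ℕ.^ j₁ ℕ.* 2 ℕ.^ j₂) ≡ 4 ℕ.^ s
  2^s*2^s≡4^s = trans (cong (2 ℕ.^ s ℕ.*_) (sym (ℕₚ.^-distribˡ-+-* 2 j₁ j₂))) (trans (sym (ℕₚ.^-distribˡ-+-* 2 s s)) (sym (4^≡2^ s)))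

J9-total-value : ∀ N → ℕ→ℚ (J9-total (2 ℕ.+ N)) * μ² (2 ℕ.+ N) ≡ rhs9 (2 ℕ.+ N)
J9-total-value N = sym (begin
  (+ 1 / 9) * (+ 1 / 4) ^ℚ (2 ℕ.* n ℕ.+ 3) * (ℕ→ℚ 3 * ℕ→ℚ n * ℕ→ℚ 4 ^ℚ n - ℕ→ℚ 7 * ℕ→ℚ 4 ^ℚ n + ℕ→ℚ 16)
    ≡⟨ cong₂ (λ x y → (+ 1 / 9) * x * y) quarter-power bracket ⟩
  (+ 1 / 9) * ((+ 1 / 4) * (c * c)) * (ℕ→ℚ 36 * ℕ→ℚ Q)
    ≡⟨ regroup (+ 1 / 9) (+ 1 / 4) (ℕ→ℚ 36) c (ℕ→ℚ Q) ⟩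
  ((+ 1 / 9) * (+ 1 / 4) * ℕ→ℚ 36) * (ℕ→ℚ Q * μ² n)
    ≡⟨ ℚₚ.*-identityˡ (ℕ→ℚ Q * μ² n) ⟩
  ℕ→ℚ Q * μ² n ∎)
  where
  open ≡-Reasoning
  n Q : ℕ
  n = 2 ℕ.+ N
  Q = J9-total n
  c : ℚ
  c = 2^- suc n * 2^- suc n
  regroup : ∀ a b d c q → a * (b * (c * c)) * (d * q) ≡ (a * b * d) * (q * (c * (c * 1ℚ)))
  regroup = Solver.solve-∀ Dyadic.ℚ-ring
  quarter^ : ∀ k → (+ 1 / 4) ^ℚ k ≡ 2^- k * 2^- k
  quarter^ zero    = refl
  quarter^ (suc k) = trans (cong ((+ 1 / 4) *_) (quarter^ k)) (interchange ½ (2^- k))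
    where
    open import Data.Rational using (½)
    interchange : ∀ h x → (h * h) * (x * x) ≡ (h * x) * (h * x)
    interchange = Solver.solve-∀ Dyadic.ℚ-ring
  quarter-power : (+ 1 / 4) ^ℚ (2 ℕ.* n ℕ.+ 3) ≡ (+ 1 / 4) * (c * c)
  quarter-power = begin
    (+ 1 / 4) ^ℚ (2 ℕ.* n ℕ.+ 3)                           ≡⟨ cong ((+ 1 / 4) ^ℚ_) (arith n) ⟩
    (+ 1 / 4) * (+ 1 / 4) ^ℚ (suc n ℕ.+ suc n)             ≡⟨ cong ((+ 1 / 4) *_) (^ℚ-+ (+ 1 / 4) (suc n) (suc n)) ⟩
    (+ 1 / 4) * ((+ 1 / 4) ^ℚ suc n * (+ 1 / 4) ^ℚ suc n)  ≡⟨ cong ((+ 1 / 4) *_) (cong₂ _*_ (quarter^ (suc n)) (quarter^ (suc n))) ⟩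
    (+ 1 / 4) * (c * c)                                    ∎
    where
    arith : ∀ n → 2 ℕ.* n ℕ.+ 3 ≡ suc (suc n ℕ.+ suc n)
    arith = solve-∀
    ^ℚ-+ : ∀ q a b → q ^ℚ (a ℕ.+ b) ≡ q ^ℚ a * q ^ℚ b
    ^ℚ-+ q zero    b = sym (ℚₚ.*-identityˡ (q ^ℚ b))
    ^ℚ-+ q (suc a) b = trans (cong (q *_) (^ℚ-+ q a b)) (sym (ℚₚ.*-assoc q (q ^ℚ a) (q ^ℚ b)))
  bracket : ℕ→ℚ 3 * ℕ→ℚ n * ℕ→ℚ 4 ^ℚ n - ℕ→ℚ 7 * ℕ→ℚ 4 ^ℚ n + ℕ→ℚ 16 ≡ ℕ→ℚ 36 * ℕ→ℚ Q
  bracket = begin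
    ℕ→ℚ 3 * ℕ→ℚ n * ℕ→ℚ 4 ^ℚ n - ℕ→ℚ 7 * ℕ→ℚ 4 ^ℚ n + ℕ→ℚ 16
      ≡⟨ cong₂ (λ x y → x - y + ℕ→ℚ 16)
               (trans (cong (ℕ→ℚ 3 * ℕ→ℚ n *_) (ℕ→ℚ-^ 4 n))
                      (trans (cong (_* ℕ→ℚ (4 ℕ.^ n)) (sym (ℕ→ℚ-* 3 n))) (sym (ℕ→ℚ-* (3 ℕ.* n) (4 ℕ.^ n)))))
               (trans (cong (ℕ→ℚ 7 *_) (ℕ→ℚ-^ 4 n)) (sym (ℕ→ℚ-* 7 (4 ℕ.^ n)))) ⟩
    ℕ→ℚ (3 ℕ.* n ℕ.* 4 ℕ.^ n) - ℕ→ℚ (7 ℕ.* 4 ℕ.^ n) + ℕ→ℚ 16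
      ≡⟨ swap (ℕ→ℚ (3 ℕ.* n ℕ.* 4 ℕ.^ n)) (ℕ→ℚ (7 ℕ.* 4 ℕ.^ n)) (ℕ→ℚ 16) ⟩
    (ℕ→ℚ (3 ℕ.* n ℕ.* 4 ℕ.^ n) + ℕ→ℚ 16) - ℕ→ℚ (7 ℕ.* 4 ℕ.^ n)
      ≡⟨ cong (_- ℕ→ℚ (7 ℕ.* 4 ℕ.^ n)) (trans (sym (ℕ→ℚ-+ (3 ℕ.* n ℕ.* 4 ℕ.^ n) 16))
                                              (cong ℕ→ℚ (sym (J9-total-closed N)))) ⟩
    ℕ→ℚ (36 ℕ.* Q ℕ.+ 7 ℕ.* 4 ℕ.^ n) - ℕ→ℚ (7 ℕ.* 4 ℕ.^ n)
      ≡⟨ cong (_- ℕ→ℚ (7 ℕ.* 4 ℕ.^ n)) (ℕ→ℚ-+ (36 ℕ.* Q) (7 ℕ.* 4 ℕ.^ n)) ⟩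
    (ℕ→ℚ (36 ℕ.* Q) + ℕ→ℚ (7 ℕ.* 4 ℕ.^ n)) - ℕ→ℚ (7 ℕ.* 4 ℕ.^ n)
      ≡⟨ cancel (ℕ→ℚ (36 ℕ.* Q)) (ℕ→ℚ (7 ℕ.* 4 ℕ.^ n)) ⟩
    ℕ→ℚ (36 ℕ.* Q)
      ≡⟨ ℕ→ℚ-* 36 Q ⟩
    ℕ→ℚ 36 * ℕ→ℚ Q ∎
    where
    swap : ∀ x y z → x - y + z ≡ (x + z) - y
    swap = Solver.solve-∀ Dyadic.ℚ-ring
    cancel : ∀ w y → (w + y) - y ≡ w
    cancel = Solver.solve-∀ Dyadic.ℚ-ring

lemma9 : (n : ℕ) → 3 ≤ n → (a : Fin (n ∸ 1) → Bool) → (σ : Fin n → Bool) →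
    lhs9 n a σ ≡ rhs9 n
lemma9 (suc (suc N)) (s≤s (s≤s _)) a σ = begin
  lhs9 n a σ
    ≡⟨ Σ<-cong (suc n) (λ j₁ _ → Σ<-cong (suc n) (λ j₂ _ → J9-term n a σ j₁ j₂)) ⟩
  Σ< (suc n) (λ j₁ → Σ< (suc n) (λ j₂ → ℕ→ℚ (J9-weight n j₁ j₂) * μ² n))
    ≡⟨ Σ<-cong (suc n) (λ j₁ _ → Σ<-ℕ (suc n) (J9-weight n j₁) (μ² n)) ⟩
  Σ< (suc n) (λ j₁ → ℕ→ℚ (Σℕ (suc n) (J9-weight n j₁)) * μ² n)
    ≡⟨ Σ<-ℕ (suc n) (λ j₁ → Σℕ (suc n) (J9-weight n j₁)) (μ² n) ⟩
  ℕ→ℚ (J9-total n) * μ² n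
    ≡⟨ J9-total-value N ⟩
  rhs9 n ∎
  where
  open ≡-Reasoning
  n : ℕ
  n = suc (suc N)
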